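{- Let $\mathcal{S}$ be a partial plane spread of size $16$ in $\mathrm{PG}(6,2)$ whose hole set $N$ satisfies $\dim\langle N\rangle=7$. Then $N$ contains exactly $7$ lines, and no two of these lines are skew.
   Context: A partial plane spread is a set of $3$-dimensional subspaces (blocks) of $\mathbb{F}_2^7$ pairwise intersecting in $\{0\}$; holes are the points ($1$-dimensional subspaces) not in any block. A line is a $2$-dimensional subspace, "contained in $N$" meaning all three of its points are holes; two lines are skew if they intersect in $\{0\}$. -}

module Defs where

open import Data.Bool using (Bool; true; false; _xor_; _∧_)
open import Data.Vec using (Vec; replicate; zipWith; map)
open import Data.Nat using (ℕ)
open import Data.Fin using (Fin)
open import Data.List using (List; foldr)
open import Data.List.Relation.Unary.All using (All)
open import Data.Product using (Σ; ∃; _×_; _,_)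
open import Relation.Binary.PropositionalEquality using (_≡_)
open import Relation.Nullary using (¬_)

-- The ambient space F₂⁷ (so the projective space is PG(6,2)).
V : Set
V = Vec Bool 7

𝟎 : V
𝟎 = replicate 7 false

_⊕_ : V → V → V
_⊕_ = zipWith _xor_

_·_ : Bool → V → V
a · x = map (a ∧_) x

-- A point (1-dim subspace) is identified with its unique nonzero vector.
IsPoint : V → Set
IsPoint x = ¬ (x ≡ 𝟎)

InSpan3 : V → V → V → V → Set
InSpan3 u v w x = Σ Bool λ a → Σ Bool λ b → Σ Bool λ c → x ≡ (a · u) ⊕ ((b · v) ⊕ (c · w))

InSpan2 : V → V → V → Set
InSpan2 u v x = Σ Bool λ a → Σ Bool λ b → x ≡ (a · u) ⊕ (b · v)

Indep3 : V → V → V → Set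
Indep3 u v w = ∀ a b c → (a · u) ⊕ ((b · v) ⊕ (c · w)) ≡ 𝟎 → (a ≡ false) × (b ≡ false) × (c ≡ false)

Indep2 : V → V → Set
Indep2 u v = ∀ a b → (a · u) ⊕ (b · v) ≡ 𝟎 → (a ≡ false) × (b ≡ false)

-- A plane (3-dim subspace) given by a basis
record Plane : Set where
  constructor plane
  field
    p₁ p₂ p₃ : V
    indep : Indep3 p₁ p₂ p₃

InPlane : Plane → V → Set
InPlane (plane u v w _) x = InSpan3 u v w x

-- A line (2-dim subspace) given by a basis
record Line : Set where
  constructor line
  field
    l₁ l₂ : V
    indep : Indep2 l₁ l₂

InLine : Line → V → Set
InLine (line u v _) x = InSpan2 u v x

SameLine : Line → Line → Set
SameLine L M = ∀ x → (InLine L x → InLine M x) × (InLine M x → InLine L x)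

Skew : Line → Line → Set
Skew L M = ∀ x → InLine L x → InLine M x → x ≡ 𝟎

-- A partial plane spread of size k: k blocks, pairwise meeting in {0}
-- (pairwise trivial intersection forces the k blocks to be distinct).
IsPartialPlaneSpread : {k : ℕ} → (Fin k → Plane) → Set
IsPartialPlaneSpread {k} S = ∀ (i j : Fin k) → ¬ (i ≡ j) → ∀ x → InPlane (S i) x → InPlane (S j) x → x ≡ 𝟎

IsHole : {k : ℕ} → (Fin k → Plane) → V → Set
IsHole S x = IsPoint x × (∀ i → ¬ InPlane (S i) x)

sumV : List V → V
sumV = foldr _⊕_ 𝟎

-- dim ⟨N⟩ = 7: the holes span all of F₂⁷
HolesSpanAll : {k : ℕ} → (Fin k → Plane) → Set
HolesSpanAll S = ∀ (y : V) → ∃ λ (xs : List V) → All (IsHole S) xs × (y ≡ sumV xs)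

LineInHoles : {k : ℕ} → (Fin k → Plane) → Line → Set
LineInHoles S L = ∀ x → InLine L x → IsPoint x → IsHole S x

-- The 16 blocks cover 112 of the 127 points, so there are 15 holes.  For a nonzero
-- linear form f let c(f) be the number of holes off the hyperplane f⊥.  Every block
-- meets the 64 points off f⊥ in 0 or 4 points, so 4 ∣ c(f); as the holes span, c(f) ≠ 0,
-- hence c(f) ∈ {4, 8, 12}.  Summing over f, the first three moments of c are character
-- sums over the holes: ∑ c = 64·15, ∑ c² = 32·15² + 32·15 and ∑ c³ = 16·15³ + 48·15² − 16 D,
-- where D counts the ordered pairs of holes whose sum is a hole.  Polynomials vanishing
-- on {4, 8, 12} turn these into: exactly 7 forms have c(f) = 12, and D = 42.  For each
-- of them the 3 holes on f⊥ form a line, because every hyperplane misses an even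
-- number of them; two such lines share exactly one hole.  Their 7 · 6 = 42 ordered pairs
-- of distinct points exhaust D, so there are no other lines of holes.

module Submission where

open import Defs
open import Data.Bool using (Bool; true; false; not; _∧_; _xor_)
open import Data.Bool.Properties
  using (xor-assoc; xor-comm; xor-same; xor-identityˡ; xor-identityʳ; ∧-comm; ∧-distribˡ-xor; ∧-distribʳ-xor; ∧-zeroʳ; xor-∧-commutativeRing)
open import Algebra.Bundles using (CommutativeRing)
open import Algebra.Properties.CommutativeSemigroup (CommutativeRing.+-commutativeSemigroup xor-∧-commutativeRing) using (interchange)
import Data.Bool as Bool
open import Data.Nat using (ℕ; zero; suc; _+_; _*_; _^_; _≤_; _<_; z≤n; s≤s)
open import Data.Nat.Properties
open import Data.Nat.Tactic.RingSolver using (solve-∀)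
open import Data.Vec using (Vec; []; _∷_; replicate; zipWith; map)
open import Data.Vec.Properties
  using (≡-dec; ∷-injectiveʳ; zipWith-comm; zipWith-assoc; zipWith-identityˡ; zipWith-identityʳ; zipWith-inverseˡ; map-id; map-const)
open import Data.Fin using (Fin; zero; suc; splitAt; join; _↑ˡ_; _↑ʳ_)
open import Data.List using ([]; _∷_)
open import Data.List.Relation.Unary.All using (All; []; _∷_)
import Data.Fin.Properties as Fin
open import Data.Fin.Properties using (any?; all?; join-splitAt; splitAt-↑ˡ; splitAt-↑ʳ)
open import Data.Product using (Σ; ∃; _×_; _,_; proj₁; proj₂)
open import Data.Sum using (_⊎_; inj₁; inj₂)
open import Data.Empty using (⊥-elim)
open import Data.Nat.Divisibility using (_∣_; divides; _∣0; ∣m∣n⇒∣m+n; ∣m+n∣m⇒∣n)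
open import Function using (_∘_)
open import Relation.Nullary using (¬_; Dec; yes; no; does)
open import Relation.Nullary.Decidable using (¬?; _×-dec_; dec-true; dec-false)
open import Relation.Binary.Definitions using (DecidableEquality)
open import Relation.Binary.PropositionalEquality

private variable
  n k : ℕ

-- Vectors over 𝔽₂

𝟙 : Bool → ℕ
𝟙 true = 1
𝟙 false = 0

𝟙-idem : ∀ b → 𝟙 b * 𝟙 b ≡ 𝟙 b
𝟙-idem true = refl
𝟙-idem false = refl

true≢false : ¬ true ≡ false
true≢false ()

𝟙≡0⇒false : ∀ {b} → 𝟙 b ≡ 0 → b ≡ false
𝟙≡0⇒false {false} _ = refl

⟦_⟧ : {P : Set} → Dec P → ℕ
⟦ d ⟧ = 𝟙 (does d)

⟦⟧-pos : {A : Set} (d : Dec A) → 0 < ⟦ d ⟧ → A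
⟦⟧-pos (yes a) _ = a

infix 4 _≟ᵥ_

_≟ᵥ_ : DecidableEquality (Vec Bool n)
_≟ᵥ_ = ≡-dec Bool._≟_

⟦≟ᵥ⟧-sym : (x y : Vec Bool n) → ⟦ x ≟ᵥ y ⟧ ≡ ⟦ y ≟ᵥ x ⟧
⟦≟ᵥ⟧-sym x y with x ≟ᵥ y | y ≟ᵥ x
... | yes _ | yes _ = refl
... | no _ | no _ = refl
... | yes refl | no y≢x = ⊥-elim (y≢x refl)
... | no x≢y | yes refl = ⊥-elim (x≢y refl)

nonzero? : (x : Vec Bool n) → Dec (¬ x ≡ replicate n false)
nonzero? x = ¬? (x ≟ᵥ replicate _ false)

even⇒xor≡false : ∀ a b d m → 𝟙 a + (𝟙 b + (𝟙 d + 0)) + 6 ≡ 2 * m → (a xor b) xor d ≡ false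
even⇒xor≡false true true true m eq = ⊥-elim (even≢odd m 4 (sym eq))
even⇒xor≡false true true false m eq = refl
even⇒xor≡false true false true m eq = refl
even⇒xor≡false true false false m eq = ⊥-elim (even≢odd m 3 (sym eq))
even⇒xor≡false false true true m eq = refl
even⇒xor≡false false true false m eq = ⊥-elim (even≢odd m 3 (sym eq))
even⇒xor≡false false false true m eq = ⊥-elim (even≢odd m 3 (sym eq))
even⇒xor≡false false false false m eq = refl

infixl 7 _∙_

_∙_ : Vec Bool n → Vec Bool n → Bool
[] ∙ [] = false
(a ∷ f) ∙ (c ∷ x) = (a ∧ c) xor (f ∙ x)

⊕-comm : (x y : V) → x ⊕ y ≡ y ⊕ x
⊕-comm = zipWith-comm xor-comm

⊕-assoc : (x y z : V) → (x ⊕ y) ⊕ z ≡ x ⊕ (y ⊕ z)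
⊕-assoc = zipWith-assoc xor-assoc

⊕-identityˡ : (x : V) → 𝟎 ⊕ x ≡ x
⊕-identityˡ = zipWith-identityˡ xor-identityˡ

⊕-identityʳ : (x : V) → x ⊕ 𝟎 ≡ x
⊕-identityʳ = zipWith-identityʳ xor-identityʳ

⊕-self : (x : V) → x ⊕ x ≡ 𝟎
⊕-self x = subst (λ y → y ⊕ x ≡ 𝟎) (map-id x) (zipWith-inverseˡ xor-same x)

·-identity : (x : V) → true · x ≡ x
·-identity = map-id

·-zero : (x : V) → false · x ≡ 𝟎
·-zero x = map-const x false

⊕-cancelˡ : (x y : V) → x ⊕ (x ⊕ y) ≡ y
⊕-cancelˡ x y = begin
  x ⊕ (x ⊕ y)  ≡⟨ ⊕-assoc x x y ⟨
  (x ⊕ x) ⊕ y  ≡⟨ cong (_⊕ y) (⊕-self x) ⟩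
  𝟎 ⊕ y        ≡⟨ ⊕-identityˡ y ⟩
  y            ∎
  where open ≡-Reasoning

⊕≡𝟎⇒≡ : (x y : V) → x ⊕ y ≡ 𝟎 → x ≡ y
⊕≡𝟎⇒≡ x y x⊕y≡𝟎 = begin
  x            ≡⟨ ⊕-cancelˡ y x ⟨
  y ⊕ (y ⊕ x)  ≡⟨ cong (y ⊕_) (trans (⊕-comm y x) x⊕y≡𝟎) ⟩
  y ⊕ 𝟎        ≡⟨ ⊕-identityʳ y ⟩
  y            ∎
  where open ≡-Reasoning

xor≡false⇒≡ : ∀ {a b} → a xor b ≡ false → a ≡ b
xor≡false⇒≡ {true} {true} _ = refl
xor≡false⇒≡ {false} {false} _ = refl

⊕-interchange : (a b c d : Vec Bool n) →
  zipWith _xor_ (zipWith _xor_ a b) (zipWith _xor_ c d) ≡ zipWith _xor_ (zipWith _xor_ a c) (zipWith _xor_ b d)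
⊕-interchange [] [] [] [] = refl
⊕-interchange (a ∷ as) (b ∷ bs) (c ∷ cs) (d ∷ ds) = cong₂ _∷_ (interchange a b c d) (⊕-interchange as bs cs ds)

·-distribʳ-xor : (a b : Bool) (x : Vec Bool n) → map ((a xor b) ∧_) x ≡ zipWith _xor_ (map (a ∧_) x) (map (b ∧_) x)
·-distribʳ-xor a b [] = refl
·-distribʳ-xor a b (c ∷ x) = cong₂ _∷_ (∧-distribʳ-xor c a b) (·-distribʳ-xor a b x)

combination₂-⊕ : ∀ a b a′ b′ (u v : V) → ((a · u) ⊕ (b · v)) ⊕ ((a′ · u) ⊕ (b′ · v)) ≡ ((a xor a′) · u) ⊕ ((b xor b′) · v)
combination₂-⊕ a b a′ b′ u v =
  trans (⊕-interchange (a · u) (b · v) (a′ · u) (b′ · v))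
        (sym (cong₂ _⊕_ (·-distribʳ-xor a a′ u) (·-distribʳ-xor b b′ v)))

combination₃-⊕ : ∀ a b c a′ b′ c′ (u v w : V) →
  ((a · u) ⊕ ((b · v) ⊕ (c · w))) ⊕ ((a′ · u) ⊕ ((b′ · v) ⊕ (c′ · w)))
    ≡ ((a xor a′) · u) ⊕ (((b xor b′) · v) ⊕ ((c xor c′) · w))
combination₃-⊕ a b c a′ b′ c′ u v w =
  trans (⊕-interchange (a · u) ((b · v) ⊕ (c · w)) (a′ · u) ((b′ · v) ⊕ (c′ · w)))
        (cong₂ _⊕_ (sym (·-distribʳ-xor a a′ u)) (combination₂-⊕ b c b′ c′ v w))

∙-comm : (f x : Vec Bool n) → f ∙ x ≡ x ∙ f
∙-comm [] [] = refl
∙-comm (a ∷ f) (c ∷ x) = cong₂ _xor_ (∧-comm a c) (∙-comm f x)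

∙-distribʳ-⊕ : (f x y : Vec Bool n) → f ∙ zipWith _xor_ x y ≡ (f ∙ x) xor (f ∙ y)
∙-distribʳ-⊕ [] [] [] = refl
∙-distribʳ-⊕ (a ∷ f) (c ∷ x) (d ∷ y) = begin
  (a ∧ (c xor d)) xor f ∙ zipWith _xor_ x y     ≡⟨ cong₂ _xor_ (∧-distribˡ-xor a c d) (∙-distribʳ-⊕ f x y) ⟩
  ((a ∧ c) xor (a ∧ d)) xor (f ∙ x xor f ∙ y)   ≡⟨ interchange (a ∧ c) (a ∧ d) (f ∙ x) (f ∙ y) ⟩
  ((a ∧ c) xor f ∙ x) xor ((a ∧ d) xor f ∙ y)   ∎
  where open ≡-Reasoning

∙-distribˡ-⊕ : (f g x : Vec Bool n) → zipWith _xor_ f g ∙ x ≡ (f ∙ x) xor (g ∙ x)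
∙-distribˡ-⊕ f g x = trans (∙-comm (zipWith _xor_ f g) x)
  (trans (∙-distribʳ-⊕ x f g) (cong₂ _xor_ (∙-comm x f) (∙-comm x g)))

∙-scaleʳ : (a : Bool) (f x : Vec Bool n) → f ∙ map (a ∧_) x ≡ a ∧ f ∙ x
∙-scaleʳ a [] [] = sym (∧-zeroʳ a)
∙-scaleʳ a (c ∷ f) (d ∷ x) = begin
  (c ∧ (a ∧ d)) xor f ∙ map (a ∧_) x  ≡⟨ cong₂ _xor_ (swap c a d) (∙-scaleʳ a f x) ⟩
  (a ∧ (c ∧ d)) xor (a ∧ f ∙ x)       ≡⟨ ∧-distribˡ-xor a (c ∧ d) (f ∙ x) ⟨
  a ∧ ((c ∧ d) xor f ∙ x)             ∎
  where
  open ≡-Reasoning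
  swap : ∀ c a d → c ∧ (a ∧ d) ≡ a ∧ (c ∧ d)
  swap true a d = refl
  swap false a d = sym (∧-zeroʳ a)

∙-zeroʳ : (f : Vec Bool n) → f ∙ replicate n false ≡ false
∙-zeroʳ [] = refl
∙-zeroʳ (a ∷ f) = trans (cong (_xor f ∙ replicate _ false) (∧-zeroʳ a)) (∙-zeroʳ f)

∙-zeroˡ : (x : Vec Bool n) → replicate n false ∙ x ≡ false
∙-zeroˡ x = trans (∙-comm _ x) (∙-zeroʳ x)

∙-nondegenerate : (v : Vec Bool n) → (∀ f → f ∙ v ≡ false) → v ≡ replicate n false
∙-nondegenerate [] _ = refl
∙-nondegenerate (a ∷ v) ⊥v = cong₂ _∷_ a≡false (∙-nondegenerate v (λ f → ⊥v (false ∷ f)))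
  where
  a≡false : a ≡ false
  a≡false = trans (sym (xor-identityʳ a)) (trans (cong (a xor_) (sym (∙-zeroˡ v))) (⊥v (true ∷ replicate _ false)))

-- Sums over 𝔽₂ⁿ and over Fin k

+-≤-cancel : ∀ {a b c d} → a ≤ b → c ≤ d → a + c ≡ b + d → a ≡ b × c ≡ d
+-≤-cancel {a} {b} {c} {d} a≤b c≤d eq = a≡b , +-cancelˡ-≡ b c d (trans (cong (_+ c) (sym a≡b)) eq)
  where
  a≡b : a ≡ b
  a≡b = ≤-antisym a≤b (+-cancelʳ-≤ d b a (≤-trans (≤-reflexive (sym eq)) (+-monoʳ-≤ a c≤d)))

opaque
  ∑ : (Vec Bool n → ℕ) → ℕ
  ∑ {zero} h = h []
  ∑ {suc n} h = ∑ (h ∘ (true ∷_)) + ∑ (h ∘ (false ∷_))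

  ∑-[] : (h : Vec Bool 0 → ℕ) → ∑ h ≡ h []
  ∑-[] h = refl

  ∑-suc : (h : Vec Bool (suc n) → ℕ) → ∑ h ≡ ∑ (h ∘ (true ∷_)) + ∑ (h ∘ (false ∷_))
  ∑-suc h = refl

  ∑-cong : {g h : Vec Bool n → ℕ} → (∀ x → g x ≡ h x) → ∑ g ≡ ∑ h
  ∑-cong {zero} g≗h = g≗h []
  ∑-cong {suc n} g≗h = cong₂ _+_ (∑-cong (g≗h ∘ (true ∷_))) (∑-cong (g≗h ∘ (false ∷_)))

  ∑-distrib-+ : (g h : Vec Bool n → ℕ) → ∑ (λ x → g x + h x) ≡ ∑ g + ∑ h
  ∑-distrib-+ {zero} g h = refl
  ∑-distrib-+ {suc n} g h =
    trans (cong₂ _+_ (∑-distrib-+ (g ∘ (true ∷_)) (h ∘ (true ∷_))) (∑-distrib-+ (g ∘ (false ∷_)) (h ∘ (false ∷_))))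
          (+-interchange (∑ (g ∘ (true ∷_))) (∑ (h ∘ (true ∷_))) (∑ (g ∘ (false ∷_))) (∑ (h ∘ (false ∷_))))
    where
    +-interchange : ∀ a b c d → (a + b) + (c + d) ≡ (a + c) + (b + d)
    +-interchange = solve-∀

  *-distribˡ-∑ : (c : ℕ) (h : Vec Bool n → ℕ) → c * ∑ h ≡ ∑ (λ x → c * h x)
  *-distribˡ-∑ {zero} c h = refl
  *-distribˡ-∑ {suc n} c h =
    trans (*-distribˡ-+ c _ _) (cong₂ _+_ (*-distribˡ-∑ c (h ∘ (true ∷_))) (*-distribˡ-∑ c (h ∘ (false ∷_))))

  ∑-const : (c : ℕ) → ∑ {n} (λ _ → c) ≡ 2 ^ n * c
  ∑-const {zero} c = sym (+-identityʳ c)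
  ∑-const {suc n} c = trans (cong₂ _+_ (∑-const {n} c) (∑-const {n} c)) (double (2 ^ n) c)
    where
    double : ∀ m c → m * c + m * c ≡ 2 * m * c
    double = solve-∀

  ∑-comm : (h : Vec Bool n → Vec Bool k → ℕ) → ∑ (λ x → ∑ (λ y → h x y)) ≡ ∑ (λ y → ∑ (λ x → h x y))
  ∑-comm {zero} h = refl
  ∑-comm {suc n} h =
    trans (cong₂ _+_ (∑-comm (h ∘ (true ∷_))) (∑-comm (h ∘ (false ∷_))))
          (sym (∑-distrib-+ (λ y → ∑ (λ x → h (true ∷ x) y)) (λ y → ∑ (λ x → h (false ∷ x) y))))

  ∑-zero : ∑ {n} (λ _ → 0) ≡ 0
  ∑-zero {zero} = refl
  ∑-zero {suc n} = cong₂ _+_ (∑-zero {n}) (∑-zero {n})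

  ∑-δ : (y : Vec Bool n) (h : Vec Bool n → ℕ) → ∑ (λ x → ⟦ x ≟ᵥ y ⟧ * h x) ≡ h y
  ∑-δ [] h = +-identityʳ (h [])
  ∑-δ {suc n} (true ∷ y) h =
    trans (cong₂ _+_ (∑-δ y (h ∘ (true ∷_))) (∑-zero {n})) (+-identityʳ _)
  ∑-δ {suc n} (false ∷ y) h = cong₂ _+_ (∑-zero {n}) (∑-δ y (h ∘ (false ∷_)))

  ∑-mono-≤ : {g h : Vec Bool n → ℕ} → (∀ x → g x ≤ h x) → ∑ g ≤ ∑ h
  ∑-mono-≤ {zero} g≤h = g≤h []
  ∑-mono-≤ {suc n} g≤h = +-mono-≤ (∑-mono-≤ (g≤h ∘ (true ∷_))) (∑-mono-≤ (g≤h ∘ (false ∷_)))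

  ∑-tight : {g h : Vec Bool n → ℕ} → (∀ x → g x ≤ h x) → ∑ g ≡ ∑ h → ∀ x → g x ≡ h x
  ∑-tight {zero} g≤h ∑g≡∑h [] = ∑g≡∑h
  ∑-tight {suc n} g≤h ∑g≡∑h (true ∷ x) =
    ∑-tight (g≤h ∘ (true ∷_)) (proj₁ (+-≤-cancel (∑-mono-≤ (g≤h ∘ (true ∷_))) (∑-mono-≤ (g≤h ∘ (false ∷_))) ∑g≡∑h)) x
  ∑-tight {suc n} g≤h ∑g≡∑h (false ∷ x) =
    ∑-tight (g≤h ∘ (false ∷_)) (proj₂ (+-≤-cancel (∑-mono-≤ (g≤h ∘ (true ∷_))) (∑-mono-≤ (g≤h ∘ (false ∷_))) ∑g≡∑h)) x

  ∑-pos : (h : Vec Bool n → ℕ) → 0 < ∑ h → ∃ λ x → 0 < h x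
  ∑-pos {zero} h 0<h = [] , 0<h
  ∑-pos {suc n} h 0<∑h with ∑ (h ∘ (true ∷_)) in eq
  ... | suc _ = let x , 0<hx = ∑-pos (h ∘ (true ∷_)) (subst (0 <_) (sym eq) (s≤s z≤n)) in true ∷ x , 0<hx
  ... | zero = let x , 0<hx = ∑-pos (h ∘ (false ∷_)) 0<∑h in false ∷ x , 0<hx

*-distribʳ-∑ : (c : ℕ) (h : Vec Bool n → ℕ) → ∑ h * c ≡ ∑ (λ x → h x * c)
*-distribʳ-∑ c h = trans (*-comm (∑ h) c) (trans (*-distribˡ-∑ c h) (∑-cong (λ x → *-comm c (h x))))

∑-*-∑ : (g : Vec Bool n → ℕ) (h : Vec Bool k → ℕ) → ∑ g * ∑ h ≡ ∑ (λ x → ∑ (λ y → g x * h y))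
∑-*-∑ g h = trans (*-distribʳ-∑ (∑ h) g) (∑-cong (λ x → *-distribˡ-∑ (g x) h))

∑-+-≡ : {a b d : Vec Bool n → ℕ} → (∀ x → a x + b x ≡ d x) → ∑ a + ∑ b ≡ ∑ d
∑-+-≡ {a = a} {b} eq = trans (sym (∑-distrib-+ a b)) (∑-cong eq)

∑-linear : (a b : ℕ) {α γ δ : Vec Bool n → ℕ} → (∀ x → α x ≡ a * γ x + b * δ x) → ∑ α ≡ a * ∑ γ + b * ∑ δ
∑-linear a b {α} {γ} {δ} eq =
  trans (∑-cong eq) (trans (∑-distrib-+ _ _) (sym (cong₂ _+_ (*-distribˡ-∑ a γ) (*-distribˡ-∑ b δ))))

∑-linear′ : (k : ℕ) {α β γ δ : Vec Bool n → ℕ} → (∀ x → α x + k * β x ≡ k * γ x + k * δ x) →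
  ∑ α + k * ∑ β ≡ k * ∑ γ + k * ∑ δ
∑-linear′ k {α} {β} {γ} {δ} eq = begin
  ∑ α + k * ∑ β                ≡⟨ cong (∑ α +_) (*-distribˡ-∑ k β) ⟩
  ∑ α + ∑ (λ x → k * β x)      ≡⟨ ∑-distrib-+ _ _ ⟨
  ∑ (λ x → α x + k * β x)      ≡⟨ ∑-linear k k eq ⟩
  k * ∑ γ + k * ∑ δ            ∎
  where open ≡-Reasoning

guard : {A : Set} (d : Dec A) {l r : ℕ} → (A → l ≡ r) → ⟦ d ⟧ * l ≡ ⟦ d ⟧ * r
guard (yes a) l≡r = cong (1 *_) (l≡r a)
guard (no _) _ = refl

∑-nonzero : ∑ {n} (λ x → ⟦ nonzero? x ⟧) + 1 ≡ 2 ^ n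
∑-nonzero {n} = begin
  ∑ (λ x → ⟦ nonzero? x ⟧) + 1                                   ≡⟨ cong (∑ {n} (λ x → ⟦ nonzero? x ⟧) +_) (∑-δ (replicate n false) (λ _ → 1)) ⟨
  ∑ (λ x → ⟦ nonzero? x ⟧) + ∑ (λ x → ⟦ x ≟ᵥ replicate n false ⟧ * 1)  ≡⟨ ∑-distrib-+ _ _ ⟨
  ∑ (λ x → ⟦ nonzero? x ⟧ + ⟦ x ≟ᵥ replicate n false ⟧ * 1)          ≡⟨ ∑-cong (λ x → split (does (x ≟ᵥ replicate n false))) ⟩
  ∑ {n} (λ _ → 1)                                                ≡⟨ ∑-const 1 ⟩
  2 ^ n * 1                                                      ≡⟨ *-identityʳ (2 ^ n) ⟩
  2 ^ n                                                          ∎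
  where
  open ≡-Reasoning
  split : ∀ b → 𝟙 (not b) + 𝟙 b * 1 ≡ 1
  split true = refl
  split false = refl

∑-∙ : (f : Vec Bool n) → ¬ f ≡ replicate n false → 2 * ∑ (λ x → 𝟙 (f ∙ x)) ≡ 2 ^ n
∑-∙ [] f≢0 = ⊥-elim (f≢0 refl)
∑-∙ {suc n} (true ∷ f) _ = cong (2 *_) (begin
  ∑ (λ x → 𝟙 ((true ∷ f) ∙ x))                       ≡⟨ ∑-suc _ ⟩
  ∑ (λ y → 𝟙 (not (f ∙ y))) + ∑ (λ y → 𝟙 (f ∙ y))    ≡⟨ ∑-distrib-+ _ _ ⟨
  ∑ (λ y → 𝟙 (not (f ∙ y)) + 𝟙 (f ∙ y))              ≡⟨ ∑-cong (λ y → complement (f ∙ y)) ⟩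
  ∑ {n} (λ _ → 1)                                    ≡⟨ trans (∑-const 1) (*-identityʳ (2 ^ n)) ⟩
  2 ^ n                                              ∎)
  where
  open ≡-Reasoning
  complement : ∀ b → 𝟙 (not b) + 𝟙 b ≡ 1
  complement true = refl
  complement false = refl
∑-∙ {suc n} (false ∷ f) f≢0 = begin
  2 * ∑ (λ x → 𝟙 ((false ∷ f) ∙ x))               ≡⟨ cong (2 *_) (∑-suc _) ⟩
  2 * (∑ (λ y → 𝟙 (f ∙ y)) + ∑ (λ y → 𝟙 (f ∙ y)))  ≡⟨ cong (2 *_) (cong (∑ (λ y → 𝟙 (f ∙ y)) +_) (+-identityʳ _)) ⟨
  2 * (2 * ∑ (λ y → 𝟙 (f ∙ y)))                   ≡⟨ cong (2 *_) (∑-∙ f (f≢0 ∘ cong (false ∷_))) ⟩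
  2 * 2 ^ n                                       ∎
  where open ≡-Reasoning

nonzero-∙ : (f x : Vec Bool n) → ⟦ nonzero? x ⟧ * 𝟙 (f ∙ x) ≡ 𝟙 (f ∙ x)
nonzero-∙ f x with x ≟ᵥ replicate _ false
... | yes refl = cong 𝟙 (sym (∙-zeroʳ f))
... | no _ = +-identityʳ _

∑ᶠ : (Fin k → ℕ) → ℕ
∑ᶠ {zero} h = 0
∑ᶠ {suc k} h = h zero + ∑ᶠ (h ∘ suc)

∑ᶠ-cong : {g h : Fin k → ℕ} → (∀ i → g i ≡ h i) → ∑ᶠ g ≡ ∑ᶠ h
∑ᶠ-cong {zero} g≗h = refl
∑ᶠ-cong {suc k} g≗h = cong₂ _+_ (g≗h zero) (∑ᶠ-cong (g≗h ∘ suc))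

∑ᶠ-const : (c : ℕ) → ∑ᶠ {k} (λ _ → c) ≡ k * c
∑ᶠ-const {zero} c = refl
∑ᶠ-const {suc k} c = cong (c +_) (∑ᶠ-const {k} c)

*-distribʳ-∑ᶠ : (c : ℕ) (h : Fin k → ℕ) → ∑ᶠ h * c ≡ ∑ᶠ (λ i → h i * c)
*-distribʳ-∑ᶠ {zero} c h = refl
*-distribʳ-∑ᶠ {suc k} c h = trans (*-distribʳ-+ c (h zero) _) (cong (h zero * c +_) (*-distribʳ-∑ᶠ c (h ∘ suc)))

∣-∑ᶠ : ∀ {d} (h : Fin k → ℕ) → (∀ i → d ∣ h i) → d ∣ ∑ᶠ h
∣-∑ᶠ {zero} {d} h _ = d ∣0
∣-∑ᶠ {suc k} h d∣h = ∣m∣n⇒∣m+n (d∣h zero) (∣-∑ᶠ (h ∘ suc) (d∣h ∘ suc))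

∑-∑ᶠ-comm : (h : Fin k → Vec Bool n → ℕ) → ∑ (λ x → ∑ᶠ (λ i → h i x)) ≡ ∑ᶠ (λ i → ∑ (h i))
∑-∑ᶠ-comm {zero} h = ∑-zero
∑-∑ᶠ-comm {suc k} h = trans (∑-distrib-+ (h zero) _) (cong (∑ (h zero) +_) (∑-∑ᶠ-comm (h ∘ suc)))

∑ᶠ-single : (h : Fin k → ℕ) (i : Fin k) → (∀ j → ¬ j ≡ i → h j ≡ 0) → ∑ᶠ h ≡ h i
∑ᶠ-single {suc k} h zero others = trans (cong (h zero +_) rest) (+-identityʳ _)
  where
  rest : ∑ᶠ (h ∘ suc) ≡ 0
  rest = trans (∑ᶠ-cong (λ j → others (suc j) λ ())) (trans (∑ᶠ-const {k} 0) (*-zeroʳ k))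
∑ᶠ-single {suc k} h (suc i) others =
  trans (cong (_+ ∑ᶠ (h ∘ suc)) (others zero λ ())) (∑ᶠ-single (h ∘ suc) i (λ j j≢i → others (suc j) (j≢i ∘ Fin.suc-injective)))

∑ᶠ-pos : (h : Fin k → ℕ) → 0 < ∑ᶠ h → ∃ λ i → 0 < h i
∑ᶠ-pos {suc k} h 0<∑h with h zero in eq
... | suc _ = zero , subst (0 <_) (sym eq) (s≤s z≤n)
... | zero = let i , 0<hi = ∑ᶠ-pos (h ∘ suc) 0<∑h in suc i , 0<hi

-- Enumerating decidable subsets

record Enumeration (P : Vec Bool n → Set) (k : ℕ) : Set where
  field
    elem : Fin k → Vec Bool n
    elem-∈ : ∀ i → P (elem i)
    elem-injective : ∀ i j → elem i ≡ elem j → i ≡ j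
    elem-surjective : ∀ {v} → P v → ∃ λ i → elem i ≡ v

module _ {P : Vec Bool (suc n) → Set} {k₁ k₂ : ℕ} where

  _++ᴱ_ : Enumeration (P ∘ (true ∷_)) k₁ → Enumeration (P ∘ (false ∷_)) k₂ → Enumeration P (k₁ + k₂)
  E₁ ++ᴱ E₂ = record
    { elem = elem′ ∘ splitAt k₁
    ; elem-∈ = elem′-∈ ∘ splitAt k₁
    ; elem-injective = λ i j eq → trans (sym (join-splitAt k₁ k₂ i)) (trans (cong (join k₁ k₂) (elem′-injective _ _ eq)) (join-splitAt k₁ k₂ j))
    ; elem-surjective = surjective
    }
    where
    module E₁ = Enumeration E₁
    module E₂ = Enumeration E₂
    elem′ : Fin k₁ ⊎ Fin k₂ → Vec Bool (suc n)
    elem′ (inj₁ i) = true ∷ E₁.elem i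
    elem′ (inj₂ i) = false ∷ E₂.elem i
    elem′-∈ : ∀ i → P (elem′ i)
    elem′-∈ (inj₁ i) = E₁.elem-∈ i
    elem′-∈ (inj₂ i) = E₂.elem-∈ i
    elem′-injective : ∀ i j → elem′ i ≡ elem′ j → i ≡ j
    elem′-injective (inj₁ i) (inj₁ j) eq = cong inj₁ (E₁.elem-injective i j (∷-injectiveʳ eq))
    elem′-injective (inj₂ i) (inj₂ j) eq = cong inj₂ (E₂.elem-injective i j (∷-injectiveʳ eq))
    surjective : ∀ {v} → P v → ∃ λ i → elem′ (splitAt k₁ i) ≡ v
    surjective {true ∷ v} pv =
      let i , eq = E₁.elem-surjective pv in i ↑ˡ k₂ , trans (cong elem′ (splitAt-↑ˡ k₁ i k₂)) (cong (true ∷_) eq)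
    surjective {false ∷ v} pv =
      let i , eq = E₂.elem-surjective pv in k₁ ↑ʳ i , trans (cong elem′ (splitAt-↑ʳ k₁ k₂ i)) (cong (false ∷_) eq)

enumerate : {P : Vec Bool n → Set} (P? : ∀ v → Dec (P v)) → Enumeration P (∑ (λ v → ⟦ P? v ⟧))
enumerate {zero} {P} P? = subst (Enumeration P) (sym (∑-[] _)) (singleton (P? []))
  where
  singleton : (d : Dec (P [])) → Enumeration P ⟦ d ⟧
  singleton (yes p) = record
    { elem = λ _ → [] ; elem-∈ = λ { zero → p } ; elem-injective = λ { zero zero _ → refl } ; elem-surjective = λ { {[]} _ → zero , refl } }
  singleton (no ¬p) = record
    { elem = λ () ; elem-∈ = λ () ; elem-injective = λ () ; elem-surjective = λ { {[]} p → ⊥-elim (¬p p) } }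
enumerate {suc n} {P} P? = subst (Enumeration P) (sym (∑-suc _)) (enumerate (P? ∘ (true ∷_)) ++ᴱ enumerate (P? ∘ (false ∷_)))

module _ {P : Vec Bool n → Set} (P? : ∀ v → Dec (P v)) where

  ∑-enumeration : (E : Enumeration P k) (h : Vec Bool n → ℕ) → ∑ (λ x → ⟦ P? x ⟧ * h x) ≡ ∑ᶠ (λ i → h (Enumeration.elem E i))
  ∑-enumeration {k} E h = trans (∑-cong pointwise) (trans (∑-∑ᶠ-comm (λ i x → ⟦ x ≟ᵥ elem i ⟧ * h x)) (∑ᶠ-cong (λ i → ∑-δ (elem i) h)))
    where
    open Enumeration E
    pointwise : ∀ x → ⟦ P? x ⟧ * h x ≡ ∑ᶠ (λ i → ⟦ x ≟ᵥ elem i ⟧ * h x)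
    pointwise x with P? x
    ... | no ¬px = sym (trans (∑ᶠ-cong term≡0) (trans (∑ᶠ-const {k} 0) (*-zeroʳ k)))
      where
      term≡0 : ∀ i → ⟦ x ≟ᵥ elem i ⟧ * h x ≡ 0
      term≡0 i with x ≟ᵥ elem i
      ... | yes refl = ⊥-elim (¬px (elem-∈ i))
      ... | no _ = refl
    ... | yes px = let i₀ , elem-i₀ = elem-surjective px in sym (trans (∑ᶠ-single _ i₀ (others i₀ elem-i₀)) (at i₀ elem-i₀))
      where
      others : ∀ i₀ → elem i₀ ≡ x → ∀ j → ¬ j ≡ i₀ → ⟦ x ≟ᵥ elem j ⟧ * h x ≡ 0
      others i₀ elem-i₀ j j≢i₀ with x ≟ᵥ elem j
      ... | yes x≡ = ⊥-elim (j≢i₀ (elem-injective j i₀ (trans (sym x≡) (sym elem-i₀))))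
      ... | no _ = refl
      at : ∀ i₀ → elem i₀ ≡ x → ⟦ x ≟ᵥ elem i₀ ⟧ * h x ≡ 1 * h x
      at i₀ elem-i₀ = cong (λ b → 𝟙 b * h x) (dec-true (x ≟ᵥ elem i₀) (sym elem-i₀))

  ∑≡1⇒unique : ∑ (λ v → ⟦ P? v ⟧) ≡ 1 → ∀ {a b} → P a → P b → a ≡ b
  ∑≡1⇒unique count {a} {b} pa pb = same-index (elem-surjective pa) (elem-surjective pb)
    where
    open Enumeration (subst (Enumeration P) count (enumerate P?))
    same-index : (∃ λ i → elem i ≡ a) → (∃ λ i → elem i ≡ b) → a ≡ b
    same-index (zero , a≡) (zero , b≡) = trans (sym a≡) b≡

  ∑≡3⇒exhaust : ∑ (λ v → ⟦ P? v ⟧) ≡ 3 → ∀ {a b d} → P a → P b → P d → ¬ a ≡ b → ¬ a ≡ d → ¬ b ≡ d →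
    ∀ {x} → P x → x ≡ a ⊎ x ≡ b ⊎ x ≡ d
  ∑≡3⇒exhaust count {a} {b} {d} pa pb pd a≢b a≢d b≢d {x} px = one-of (trans (tight x) (cong 𝟙 (dec-true (P? x) px)))
    where
    marks : Vec Bool n → ℕ
    marks z = ⟦ z ≟ᵥ a ⟧ + ⟦ z ≟ᵥ b ⟧ + ⟦ z ≟ᵥ d ⟧
    marks≤P : ∀ z → marks z ≤ ⟦ P? z ⟧
    marks≤P z with z ≟ᵥ a | z ≟ᵥ b | z ≟ᵥ d
    ... | no _ | no _ | no _ = z≤n
    ... | yes refl | no _ | no _ = ≤-reflexive (cong 𝟙 (sym (dec-true (P? z) pa)))
    ... | no _ | yes refl | no _ = ≤-reflexive (cong 𝟙 (sym (dec-true (P? z) pb)))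
    ... | no _ | no _ | yes refl = ≤-reflexive (cong 𝟙 (sym (dec-true (P? z) pd)))
    ... | yes refl | yes refl | _ = ⊥-elim (a≢b refl)
    ... | yes refl | no _ | yes refl = ⊥-elim (a≢d refl)
    ... | no _ | yes refl | yes refl = ⊥-elim (b≢d refl)
    ∑marks≡3 : ∑ marks ≡ 3
    ∑marks≡3 = trans (∑-distrib-+ _ _) (cong₂ _+_ (trans (∑-distrib-+ _ _) (cong₂ _+_ (count₁ a) (count₁ b))) (count₁ d))
      where
      count₁ : ∀ y → ∑ (λ z → ⟦ z ≟ᵥ y ⟧) ≡ 1
      count₁ y = trans (∑-cong (λ z → sym (*-identityʳ _))) (∑-δ y (λ _ → 1))
    tight : ∀ z → marks z ≡ ⟦ P? z ⟧
    tight = ∑-tight marks≤P (trans ∑marks≡3 (sym count))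
    one-of : marks x ≡ 1 → x ≡ a ⊎ x ≡ b ⊎ x ≡ d
    one-of marks≡1 with x ≟ᵥ a | x ≟ᵥ b | x ≟ᵥ d
    ... | yes x≡a | _ | _ = inj₁ x≡a
    ... | no _ | yes x≡b | _ = inj₂ (inj₁ x≡b)
    ... | no _ | no _ | yes x≡d = inj₂ (inj₂ x≡d)
    ... | no _ | no _ | no _ with marks≡1
    ... | ()

  ∑-diagonal : ∀ x → ∑ (λ y → ⟦ P? x ⟧ * ⟦ P? y ⟧ * ⟦ x ≟ᵥ y ⟧) ≡ ⟦ P? x ⟧
  ∑-diagonal x = begin
    ∑ (λ y → ⟦ P? x ⟧ * ⟦ P? y ⟧ * ⟦ x ≟ᵥ y ⟧)   ≡⟨ ∑-cong (λ y → trans (*-comm (⟦ P? x ⟧ * ⟦ P? y ⟧) _) (cong (_* (⟦ P? x ⟧ * ⟦ P? y ⟧)) (⟦≟ᵥ⟧-sym x y))) ⟩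
    ∑ (λ y → ⟦ y ≟ᵥ x ⟧ * (⟦ P? x ⟧ * ⟦ P? y ⟧)) ≡⟨ ∑-δ x (λ y → ⟦ P? x ⟧ * ⟦ P? y ⟧) ⟩
    ⟦ P? x ⟧ * ⟦ P? x ⟧                         ≡⟨ 𝟙-idem (does (P? x)) ⟩
    ⟦ P? x ⟧                                     ∎
    where open ≡-Reasoning

  ∑∑-distinct : ∀ {t} → ∑ (λ v → ⟦ P? v ⟧) ≡ t → ∑ (λ x → ∑ (λ y → ⟦ P? x ×-dec (P? y ×-dec ¬? (x ≟ᵥ y)) ⟧)) + t ≡ t * t
  ∑∑-distinct {t} count = begin
    ∑ (λ x → ∑ (distinct x)) + t                          ≡⟨ cong (∑ (λ x → ∑ (distinct x)) +_) (trans (∑-cong ∑-diagonal) count) ⟨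
    ∑ (λ x → ∑ (distinct x)) + ∑ (λ x → ∑ (diagonal x))   ≡⟨ ∑-+-≡ (λ x → ∑-+-≡ (λ y → split (does (P? x)) (does (P? y)) (does (x ≟ᵥ y)))) ⟩
    ∑ (λ x → ∑ (λ y → ⟦ P? x ⟧ * ⟦ P? y ⟧))               ≡⟨ ∑-*-∑ (λ x → ⟦ P? x ⟧) (λ y → ⟦ P? y ⟧) ⟨
    ∑ (λ x → ⟦ P? x ⟧) * ∑ (λ y → ⟦ P? y ⟧)               ≡⟨ cong₂ _*_ count count ⟩
    t * t                                                 ∎
    where
    open ≡-Reasoning
    distinct diagonal : Vec Bool n → Vec Bool n → ℕ
    distinct x y = ⟦ P? x ×-dec (P? y ×-dec ¬? (x ≟ᵥ y)) ⟧
    diagonal x y = ⟦ P? x ⟧ * ⟦ P? y ⟧ * ⟦ x ≟ᵥ y ⟧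
    split : ∀ a b e → 𝟙 (a ∧ (b ∧ not e)) + 𝟙 a * 𝟙 b * 𝟙 e ≡ 𝟙 a * 𝟙 b
    split true true true = refl
    split true true false = refl
    split true false e = refl
    split false b e = refl

-- Planes and lines

coords : Plane → Vec Bool 3 → V
coords (plane u v w _) (a ∷ b ∷ c ∷ []) = (a · u) ⊕ ((b · v) ⊕ (c · w))

coords-InPlane : (P : Plane) (t : Vec Bool 3) → InPlane P (coords P t)
coords-InPlane (plane _ _ _ _) (a ∷ b ∷ c ∷ []) = a , b , c , refl

InPlane⇒coords : (P : Plane) {x : V} → InPlane P x → ∃ λ t → x ≡ coords P t
InPlane⇒coords (plane _ _ _ _) (a , b , c , x≡) = (a ∷ b ∷ c ∷ []) , x≡

coords-injective : (P : Plane) (t t′ : Vec Bool 3) → coords P t ≡ coords P t′ → t ≡ t′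
coords-injective (plane u v w indep) (a ∷ b ∷ c ∷ []) (a′ ∷ b′ ∷ c′ ∷ []) eq
  with indep (a xor a′) (b xor b′) (c xor c′) (trans (sym (combination₃-⊕ a b c a′ b′ c′ u v w)) difference≡𝟎)
  where
  difference≡𝟎 : coords (plane u v w indep) (a ∷ b ∷ c ∷ []) ⊕ coords (plane u v w indep) (a′ ∷ b′ ∷ c′ ∷ []) ≡ 𝟎
  difference≡𝟎 = trans (cong (_⊕ _) eq) (⊕-self _)
... | a≡ , b≡ , c≡ = cong₂ _∷_ (xor≡false⇒≡ a≡) (cong₂ _∷_ (xor≡false⇒≡ b≡) (cong₂ _∷_ (xor≡false⇒≡ c≡) refl))

coords-𝟎 : (P : Plane) → coords P (replicate 3 false) ≡ 𝟎
coords-𝟎 (plane u v w _) = begin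
  (false · u) ⊕ ((false · v) ⊕ (false · w))  ≡⟨ cong₂ _⊕_ (·-zero u) (cong₂ _⊕_ (·-zero v) (·-zero w)) ⟩
  𝟎 ⊕ (𝟎 ⊕ 𝟎)                                ≡⟨ trans (⊕-identityˡ _) (⊕-identityˡ 𝟎) ⟩
  𝟎                                          ∎
  where open ≡-Reasoning

restrict : V → Plane → Vec Bool 3
restrict f (plane u v w _) = f ∙ u ∷ f ∙ v ∷ f ∙ w ∷ []

∙-coords : (f : V) (P : Plane) (t : Vec Bool 3) → f ∙ coords P t ≡ restrict f P ∙ t
∙-coords f (plane u v w indep) (a ∷ b ∷ c ∷ []) = begin
  f ∙ ((a · u) ⊕ ((b · v) ⊕ (c · w)))            ≡⟨ ∙-distribʳ-⊕ f _ _ ⟩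
  f ∙ (a · u) xor f ∙ ((b · v) ⊕ (c · w))        ≡⟨ cong (f ∙ (a · u) xor_) (∙-distribʳ-⊕ f _ _) ⟩
  f ∙ (a · u) xor (f ∙ (b · v) xor f ∙ (c · w))  ≡⟨ cong₂ _xor_ (∙-scaleʳ a f u) (cong₂ _xor_ (∙-scaleʳ b f v) (∙-scaleʳ c f w)) ⟩
  (a ∧ f ∙ u) xor ((b ∧ f ∙ v) xor (c ∧ f ∙ w))  ≡⟨ cong₂ _xor_ (∧-comm a _) (cong₂ _xor_ (∧-comm b _) (trans (∧-comm c _) (sym (xor-identityʳ _)))) ⟩
  restrict f (plane u v w indep) ∙ (a ∷ b ∷ c ∷ [])  ∎
  where open ≡-Reasoning

4∣plane∖hyperplane : (f : V) (P : Plane) → 4 ∣ ∑ (λ t → ⟦ nonzero? t ⟧ * 𝟙 (f ∙ coords P t))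
4∣plane∖hyperplane f P = subst (4 ∣_) (∑-cong (λ t → sym (drop-nonzero t))) (count (restrict f P ≟ᵥ replicate 3 false))
  where
  drop-nonzero : (t : Vec Bool 3) → ⟦ nonzero? t ⟧ * 𝟙 (f ∙ coords P t) ≡ 𝟙 (restrict f P ∙ t)
  drop-nonzero t = trans (cong (λ b → ⟦ nonzero? t ⟧ * 𝟙 b) (∙-coords f P t)) (nonzero-∙ (restrict f P) t)
  count : Dec (restrict f P ≡ replicate 3 false) → 4 ∣ ∑ (λ t → 𝟙 (restrict f P ∙ t))
  count (yes r≡0) = divides 0 (trans (∑-cong (λ t → cong 𝟙 (trans (cong (_∙ t) r≡0) (∙-zeroˡ t)))) ∑-zero)
  count (no r≢0) = divides 1 (*-cancelˡ-≡ _ _ 2 (∑-∙ (restrict f P) r≢0))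

∃-Bool? : {P : Bool → Set} → (∀ a → Dec (P a)) → Dec (Σ Bool P)
∃-Bool? P? with P? true | P? false
... | yes p | _ = yes (true , p)
... | no _ | yes p = yes (false , p)
... | no ¬p | no ¬q = no λ { (true , p) → ¬p p ; (false , q) → ¬q q }

inPlane? : (P : Plane) (x : V) → Dec (InPlane P x)
inPlane? (plane u v w _) x = ∃-Bool? λ a → ∃-Bool? λ b → ∃-Bool? λ c → x ≟ᵥ ((a · u) ⊕ ((b · v) ⊕ (c · w)))

module _ (u v : V) where

  span₂-𝟎 : InSpan2 u v 𝟎
  span₂-𝟎 = false , false , sym (trans (cong₂ _⊕_ (·-zero u) (·-zero v)) (⊕-identityˡ 𝟎))

  span₂-left : InSpan2 u v u
  span₂-left = true , false , sym (trans (cong₂ _⊕_ (·-identity u) (·-zero v)) (⊕-identityʳ u))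

  span₂-right : InSpan2 u v v
  span₂-right = false , true , sym (trans (cong₂ _⊕_ (·-zero u) (·-identity v)) (⊕-identityˡ v))

  span₂-sum : InSpan2 u v (u ⊕ v)
  span₂-sum = true , true , sym (cong₂ _⊕_ (·-identity u) (·-identity v))

  span₂-cases : ∀ {x} → InSpan2 u v x → x ≡ 𝟎 ⊎ x ≡ u ⊎ x ≡ v ⊎ x ≡ u ⊕ v
  span₂-cases (false , false , x≡) = inj₁ (trans x≡ (sym (proj₂ (proj₂ span₂-𝟎))))
  span₂-cases (true , false , x≡) = inj₂ (inj₁ (trans x≡ (sym (proj₂ (proj₂ span₂-left)))))
  span₂-cases (false , true , x≡) = inj₂ (inj₂ (inj₁ (trans x≡ (sym (proj₂ (proj₂ span₂-right))))))
  span₂-cases (true , true , x≡) = inj₂ (inj₂ (inj₂ (trans x≡ (sym (proj₂ (proj₂ span₂-sum))))))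

  span₂-⊕ : ∀ {x y} → InSpan2 u v x → InSpan2 u v y → InSpan2 u v (x ⊕ y)
  span₂-⊕ (a , b , refl) (a′ , b′ , refl) = (a xor a′) , (b xor b′) , combination₂-⊕ a b a′ b′ u v

  distinct⇒Indep2 : ¬ u ≡ 𝟎 → ¬ v ≡ 𝟎 → ¬ u ≡ v → Indep2 u v
  distinct⇒Indep2 u≢𝟎 v≢𝟎 u≢v true true eq = ⊥-elim (u≢v (⊕≡𝟎⇒≡ u v (trans (proj₂ (proj₂ span₂-sum)) eq)))
  distinct⇒Indep2 u≢𝟎 v≢𝟎 u≢v true false eq = ⊥-elim (u≢𝟎 (trans (proj₂ (proj₂ span₂-left)) eq))
  distinct⇒Indep2 u≢𝟎 v≢𝟎 u≢v false true eq = ⊥-elim (v≢𝟎 (trans (proj₂ (proj₂ span₂-right)) eq))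
  distinct⇒Indep2 u≢𝟎 v≢𝟎 u≢v false false eq = refl , refl

  module Independent (ind : Indep2 u v) where

    u≢𝟎 : ¬ u ≡ 𝟎
    u≢𝟎 eq = true≢false (proj₁ (ind true false (trans (sym (proj₂ (proj₂ span₂-left))) eq)))

    v≢𝟎 : ¬ v ≡ 𝟎
    v≢𝟎 eq = true≢false (proj₂ (ind false true (trans (sym (proj₂ (proj₂ span₂-right))) eq)))

    u⊕v≢𝟎 : ¬ u ⊕ v ≡ 𝟎
    u⊕v≢𝟎 eq = true≢false (proj₁ (ind true true (trans (sym (proj₂ (proj₂ span₂-sum))) eq)))

    u≢v : ¬ u ≡ v
    u≢v eq = u⊕v≢𝟎 (trans (cong (_⊕ v) eq) (⊕-self v))

    u≢u⊕v : ¬ u ≡ u ⊕ v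
    u≢u⊕v eq = v≢𝟎 (trans (sym (⊕-cancelˡ u v)) (trans (cong (u ⊕_) (sym eq)) (⊕-self u)))

    v≢u⊕v : ¬ v ≡ u ⊕ v
    v≢u⊕v eq = u≢𝟎 (trans (sym (⊕-cancelˡ v u)) (trans (cong (v ⊕_) (trans (⊕-comm v u) (sym eq))) (⊕-self v)))

-- Holes of a partial plane spread

off : {P : V → Set} → ((x : V) → Dec (P x)) → V → ℕ
off P? f = ∑ (λ x → ⟦ P? x ⟧ * 𝟙 (f ∙ x))

module Holes {k : ℕ} (S : Fin k → Plane) (spread : IsPartialPlaneSpread S) where

  isHole? : (x : V) → Dec (IsHole S x)
  isHole? x = ¬? (x ≟ᵥ 𝟎) ×-dec all? (λ i → ¬? (inPlane? (S i) x))

  multiplicity : V → ℕ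
  multiplicity x = ∑ᶠ λ i → ∑ λ t → ⟦ nonzero? t ⟧ * ⟦ x ≟ᵥ coords (S i) t ⟧

  multiplicity≡0 : (x : V) → (∀ i t → ¬ t ≡ replicate 3 false → ¬ x ≡ coords (S i) t) → multiplicity x ≡ 0
  multiplicity≡0 x ∉ = trans (∑ᶠ-cong {k} (λ i → trans (∑-cong (term≡0 i)) ∑-zero)) (trans (∑ᶠ-const {k} 0) (*-zeroʳ k))
    where
    term≡0 : ∀ i t → ⟦ nonzero? t ⟧ * ⟦ x ≟ᵥ coords (S i) t ⟧ ≡ 0
    term≡0 i t with t ≟ᵥ replicate 3 false | x ≟ᵥ coords (S i) t
    ... | yes _ | _ = refl
    ... | no _ | no _ = refl
    ... | no t≢0 | yes x≡ = ⊥-elim (∉ i t t≢0 x≡)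

  multiplicity≡1 : (x : V) (i : Fin k) → ¬ x ≡ 𝟎 → InPlane (S i) x → multiplicity x ≡ 1
  multiplicity≡1 x i x≢𝟎 x∈Sᵢ =
    trans (∑ᶠ-single _ i others) (trans (∑-cong in-Sᵢ) (trans (∑-δ t₀ (λ t → ⟦ nonzero? t ⟧)) (cong 𝟙 (dec-true (nonzero? t₀) t₀≢0))))
    where
    t₀ = proj₁ (InPlane⇒coords (S i) x∈Sᵢ)
    x≡ = proj₂ (InPlane⇒coords (S i) x∈Sᵢ)
    t₀≢0 : ¬ t₀ ≡ replicate 3 false
    t₀≢0 t₀≡0 = x≢𝟎 (trans x≡ (trans (cong (coords (S i)) t₀≡0) (coords-𝟎 (S i))))
    others : ∀ j → ¬ j ≡ i → ∑ (λ t → ⟦ nonzero? t ⟧ * ⟦ x ≟ᵥ coords (S j) t ⟧) ≡ 0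
    others j j≢i = trans (∑-cong term≡0) ∑-zero
      where
      term≡0 : ∀ t → ⟦ nonzero? t ⟧ * ⟦ x ≟ᵥ coords (S j) t ⟧ ≡ 0
      term≡0 t with x ≟ᵥ coords (S j) t
      ... | no _ = *-zeroʳ ⟦ nonzero? t ⟧
      ... | yes x≡′ = ⊥-elim (x≢𝟎 (spread j i j≢i x (subst (InPlane (S j)) (sym x≡′) (coords-InPlane (S j) t)) x∈Sᵢ))
    in-Sᵢ : ∀ t → ⟦ nonzero? t ⟧ * ⟦ x ≟ᵥ coords (S i) t ⟧ ≡ ⟦ t ≟ᵥ t₀ ⟧ * ⟦ nonzero? t ⟧
    in-Sᵢ t with t ≟ᵥ t₀ | x ≟ᵥ coords (S i) t
    ... | yes refl | yes _ = *-comm _ 1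
    ... | no _ | no _ = *-zeroʳ ⟦ nonzero? t ⟧
    ... | yes refl | no x≢ = ⊥-elim (x≢ x≡)
    ... | no t≢t₀ | yes x≡′ = ⊥-elim (t≢t₀ (coords-injective (S i) t t₀ (trans (sym x≡′) x≡)))

  hole+multiplicity : (x : V) → ⟦ isHole? x ⟧ + multiplicity x ≡ ⟦ nonzero? x ⟧
  hole+multiplicity x = cases (x ≟ᵥ 𝟎) (any? (λ i → inPlane? (S i) x))
    where
    not-a-hole : ¬ IsHole S x → ⟦ isHole? x ⟧ ≡ 0
    not-a-hole ¬hole = cong 𝟙 (dec-false (isHole? x) ¬hole)
    cases : Dec (x ≡ 𝟎) → Dec (∃ λ i → InPlane (S i) x) → ⟦ isHole? x ⟧ + multiplicity x ≡ ⟦ nonzero? x ⟧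
    cases (yes refl) _ =
      multiplicity≡0 𝟎 λ i t t≢0 𝟎≡ → t≢0 (coords-injective (S i) t _ (trans (sym 𝟎≡) (sym (coords-𝟎 (S i)))))
    cases (no x≢𝟎) (yes (i , x∈Sᵢ)) = begin
      ⟦ isHole? x ⟧ + multiplicity x  ≡⟨ cong₂ _+_ (not-a-hole λ hole → proj₂ hole i x∈Sᵢ) (multiplicity≡1 x i x≢𝟎 x∈Sᵢ) ⟩
      1                              ≡⟨ cong 𝟙 (dec-true (nonzero? x) x≢𝟎) ⟨
      ⟦ nonzero? x ⟧                 ∎
      where open ≡-Reasoning
    cases (no x≢𝟎) (no x∉) = begin
      ⟦ isHole? x ⟧ + multiplicity x  ≡⟨ cong₂ _+_ (cong 𝟙 (dec-true (isHole? x) (x≢𝟎 , λ i x∈Sᵢ → x∉ (i , x∈Sᵢ)))) x∉⇒0 ⟩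
      1                              ≡⟨ cong 𝟙 (dec-true (nonzero? x) x≢𝟎) ⟨
      ⟦ nonzero? x ⟧                 ∎
      where
      open ≡-Reasoning
      x∉⇒0 = multiplicity≡0 x λ i t _ x≡ → x∉ (i , subst (InPlane (S i)) (sym x≡) (coords-InPlane (S i) t))

  ∑-multiplicity : (w : V → ℕ) → ∑ (λ x → multiplicity x * w x) ≡ ∑ᶠ {k} (λ i → ∑ (λ t → ⟦ nonzero? t ⟧ * w (coords (S i) t)))
  ∑-multiplicity w = begin
    ∑ (λ x → multiplicity x * w x)                                   ≡⟨ ∑-cong (λ x → *-distribʳ-∑ᶠ {k} (w x) _) ⟩
    ∑ (λ x → ∑ᶠ {k} (λ i → ∑ (λ t → nz t * δ x i t) * w x))              ≡⟨ ∑-∑ᶠ-comm {k} _ ⟩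
    ∑ᶠ {k} (λ i → ∑ (λ x → ∑ (λ t → nz t * δ x i t) * w x))              ≡⟨ ∑ᶠ-cong {k} (λ i → ∑-cong (λ x → *-distribʳ-∑ (w x) _)) ⟩
    ∑ᶠ {k} (λ i → ∑ (λ x → ∑ (λ t → nz t * δ x i t * w x)))              ≡⟨ ∑ᶠ-cong {k} (λ i → ∑-comm _) ⟩
    ∑ᶠ {k} (λ i → ∑ (λ t → ∑ (λ x → nz t * δ x i t * w x)))              ≡⟨ ∑ᶠ-cong {k} (λ i → ∑-cong (λ t → ∑-cong (λ x → shuffle (nz t) (δ x i t) (w x)))) ⟩
    ∑ᶠ {k} (λ i → ∑ (λ t → ∑ (λ x → δ x i t * (nz t * w x))))            ≡⟨ ∑ᶠ-cong {k} (λ i → ∑-cong (λ t → ∑-δ (coords (S i) t) (λ x → nz t * w x))) ⟩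
    ∑ᶠ {k} (λ i → ∑ (λ t → nz t * w (coords (S i) t)))                   ∎
    where
    open ≡-Reasoning
    nz : Vec Bool 3 → ℕ
    nz t = ⟦ nonzero? t ⟧
    δ : V → Fin k → Vec Bool 3 → ℕ
    δ x i t = ⟦ x ≟ᵥ coords (S i) t ⟧
    shuffle : ∀ a b c → a * b * c ≡ b * (a * c)
    shuffle = solve-∀

  -- Counting every nonzero point once, either as a hole or through the block containing it.
  ∑-holes : (w : V → ℕ) →
    ∑ (λ x → ⟦ isHole? x ⟧ * w x) + ∑ᶠ {k} (λ i → ∑ (λ t → ⟦ nonzero? t ⟧ * w (coords (S i) t))) ≡ ∑ (λ x → ⟦ nonzero? x ⟧ * w x)
  ∑-holes w = begin
    ∑ (λ x → ⟦ isHole? x ⟧ * w x) + ∑ᶠ {k} (λ i → ∑ (λ t → ⟦ nonzero? t ⟧ * w (coords (S i) t)))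
      ≡⟨ cong (∑ (λ x → ⟦ isHole? x ⟧ * w x) +_) (∑-multiplicity w) ⟨
    ∑ (λ x → ⟦ isHole? x ⟧ * w x) + ∑ (λ x → multiplicity x * w x)
      ≡⟨ ∑-distrib-+ _ _ ⟨
    ∑ (λ x → ⟦ isHole? x ⟧ * w x + multiplicity x * w x)
      ≡⟨ ∑-cong (λ x → trans (sym (*-distribʳ-+ (w x) ⟦ isHole? x ⟧ (multiplicity x))) (cong (_* w x) (hole+multiplicity x))) ⟩
    ∑ (λ x → ⟦ nonzero? x ⟧ * w x)
      ∎
    where open ≡-Reasoning

  hole-count : ∑ (λ x → ⟦ isHole? x ⟧) + k * 7 ≡ 127
  hole-count = begin
    ∑ (λ x → ⟦ isHole? x ⟧) + k * 7
      ≡⟨ cong₂ _+_ (∑-cong (λ x → sym (*-identityʳ _))) (sym (trans (∑ᶠ-cong {k} (λ _ → points-per-block)) (∑ᶠ-const {k} 7))) ⟩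
    ∑ (λ x → ⟦ isHole? x ⟧ * 1) + ∑ᶠ {k} (λ i → ∑ (λ t → ⟦ nonzero? t ⟧ * 1))
      ≡⟨ ∑-holes (λ _ → 1) ⟩
    ∑ (λ x → ⟦ nonzero? x ⟧ * 1)
      ≡⟨ +-cancelʳ-≡ 1 _ _ (trans (cong (_+ 1) (∑-cong (λ x → *-identityʳ _))) ∑-nonzero) ⟩
    127 ∎
    where
    open ≡-Reasoning
    points-per-block : ∑ (λ t → ⟦ nonzero? {3} t ⟧ * 1) ≡ 7
    points-per-block = +-cancelʳ-≡ 1 _ _ (trans (cong (_+ 1) (∑-cong (λ t → *-identityʳ _))) ∑-nonzero)

  4∣off : (f : V) → 4 ∣ off isHole? f
  4∣off f = ∣m+n∣m⇒∣n (subst (4 ∣_) (trans (sym (∑-holes (λ x → 𝟙 (f ∙ x)))) (+-comm (off isHole? f) _)) 4∣all)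
                      (∣-∑ᶠ _ (λ i → 4∣plane∖hyperplane f (S i)))
    where
    4∣all : 4 ∣ ∑ (λ x → ⟦ nonzero? x ⟧ * 𝟙 (f ∙ x))
    4∣all with f ≟ᵥ 𝟎
    ... | yes refl = divides 0 (trans (∑-cong (λ x → cong (λ b → ⟦ nonzero? x ⟧ * 𝟙 b) (∙-zeroˡ x))) (trans (∑-cong (λ x → *-zeroʳ ⟦ nonzero? x ⟧)) ∑-zero))
    ... | no f≢𝟎 = divides 16 (trans (∑-cong (nonzero-∙ f)) (*-cancelˡ-≡ _ _ 2 (∑-∙ f f≢𝟎)))

  off≢0 : HolesSpanAll S → (f : V) → ¬ f ≡ 𝟎 → ¬ off isHole? f ≡ 0
  off≢0 span f f≢𝟎 off≡0 = f≢𝟎 (∙-nondegenerate f λ y → trans (∙-comm y f) (f⊥ y))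
    where
    f⊥hole : ∀ {x} → IsHole S x → f ∙ x ≡ false
    f⊥hole {x} hole = 𝟙≡0⇒false (begin
      𝟙 (f ∙ x)                     ≡⟨ +-identityʳ _ ⟨
      1 * 𝟙 (f ∙ x)                 ≡⟨ cong (λ b → 𝟙 b * 𝟙 (f ∙ x)) (dec-true (isHole? x) hole) ⟨
      ⟦ isHole? x ⟧ * 𝟙 (f ∙ x)     ≡⟨ ∑-tight (λ _ → z≤n) (trans ∑-zero (sym off≡0)) x ⟨
      0                             ∎)
      where open ≡-Reasoning
    f⊥sum : ∀ xs → All (IsHole S) xs → f ∙ sumV xs ≡ false
    f⊥sum [] [] = ∙-zeroʳ f
    f⊥sum (x ∷ xs) (hole ∷ holes) = trans (∙-distribʳ-⊕ f x (sumV xs)) (cong₂ _xor_ (f⊥hole hole) (f⊥sum xs holes))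
    f⊥ : ∀ y → f ∙ y ≡ false
    f⊥ y = let xs , holes , y≡ = span y in trans (cong (f ∙_) y≡) (f⊥sum xs holes)

-- Character sums over the linear forms on V

Φ : V → ℕ
Φ v = ∑ (λ f → 𝟙 (f ∙ v))

Φ-nonzero : (v : V) → ¬ v ≡ 𝟎 → Φ v ≡ 64
Φ-nonzero v v≢𝟎 = *-cancelˡ-≡ _ _ 2 (trans (cong (2 *_) (∑-cong (λ f → cong 𝟙 (∙-comm f v)))) (∑-∙ v v≢𝟎))

Φ-⊕ : (x y : V) → Φ (x ⊕ y) + 64 * ⟦ x ≟ᵥ y ⟧ ≡ 64
Φ-⊕ x y with x ≟ᵥ y
... | yes refl = cong (_+ 64) (trans (∑-cong (λ f → cong 𝟙 (trans (cong (f ∙_) (⊕-self x)) (∙-zeroʳ f)))) ∑-zero)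
... | no x≢y = trans (+-identityʳ _) (Φ-nonzero (x ⊕ y) (x≢y ∘ ⊕≡𝟎⇒≡ x y))

Φ₂ : V → V → ℕ
Φ₂ x y = ∑ (λ f → 𝟙 (f ∙ x) * 𝟙 (f ∙ y))

Φ₃ : V → V → V → ℕ
Φ₃ x y z = ∑ (λ f → 𝟙 (f ∙ x) * 𝟙 (f ∙ y) * 𝟙 (f ∙ z))

2Φ₂+Φ≡Φ+Φ : (x y : V) → 2 * Φ₂ x y + Φ (x ⊕ y) ≡ Φ x + Φ y
2Φ₂+Φ≡Φ+Φ x y = begin
  2 * Φ₂ x y + Φ (x ⊕ y)                                  ≡⟨ cong (_+ Φ (x ⊕ y)) (*-distribˡ-∑ 2 _) ⟩
  ∑ (λ f → 2 * (𝟙 (f ∙ x) * 𝟙 (f ∙ y))) + Φ (x ⊕ y)      ≡⟨ ∑-distrib-+ _ _ ⟨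
  ∑ (λ f → 2 * (𝟙 (f ∙ x) * 𝟙 (f ∙ y)) + 𝟙 (f ∙ (x ⊕ y))) ≡⟨ ∑-cong pointwise ⟩
  ∑ (λ f → 𝟙 (f ∙ x) + 𝟙 (f ∙ y))                        ≡⟨ ∑-distrib-+ _ _ ⟩
  Φ x + Φ y                                              ∎
  where
  open ≡-Reasoning
  table : ∀ a b → 2 * (𝟙 a * 𝟙 b) + 𝟙 (a xor b) ≡ 𝟙 a + 𝟙 b
  table true true = refl
  table true false = refl
  table false true = refl
  table false false = refl
  pointwise : ∀ f → 2 * (𝟙 (f ∙ x) * 𝟙 (f ∙ y)) + 𝟙 (f ∙ (x ⊕ y)) ≡ 𝟙 (f ∙ x) + 𝟙 (f ∙ y)
  pointwise f rewrite ∙-distribʳ-⊕ f x y = table (f ∙ x) (f ∙ y)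

4Φ₃+Φ+Φ+Φ≡Φ+Φ+Φ+Φ : (x y z : V) →
  4 * Φ₃ x y z + Φ (x ⊕ y) + Φ (x ⊕ z) + Φ (y ⊕ z) ≡ Φ x + Φ y + Φ z + Φ ((x ⊕ y) ⊕ z)
4Φ₃+Φ+Φ+Φ≡Φ+Φ+Φ+Φ x y z = begin
  4 * Φ₃ x y z + Φ (x ⊕ y) + Φ (x ⊕ z) + Φ (y ⊕ z)
    ≡⟨ cong (λ t → t + Φ (x ⊕ y) + Φ (x ⊕ z) + Φ (y ⊕ z)) (*-distribˡ-∑ 4 _) ⟩
  ∑ (λ f → 4 * (𝟙 (f ∙ x) * 𝟙 (f ∙ y) * 𝟙 (f ∙ z))) + Φ (x ⊕ y) + Φ (x ⊕ z) + Φ (y ⊕ z)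
    ≡⟨ ∑-distrib-+₄ _ _ _ _ ⟨
  ∑ (λ f → 4 * (𝟙 (f ∙ x) * 𝟙 (f ∙ y) * 𝟙 (f ∙ z)) + 𝟙 (f ∙ (x ⊕ y)) + 𝟙 (f ∙ (x ⊕ z)) + 𝟙 (f ∙ (y ⊕ z)))
    ≡⟨ ∑-cong pointwise ⟩
  ∑ (λ f → 𝟙 (f ∙ x) + 𝟙 (f ∙ y) + 𝟙 (f ∙ z) + 𝟙 (f ∙ ((x ⊕ y) ⊕ z)))
    ≡⟨ ∑-distrib-+₄ _ _ _ _ ⟩
  Φ x + Φ y + Φ z + Φ ((x ⊕ y) ⊕ z)
    ∎
  where
  open ≡-Reasoning
  ∑-distrib-+₄ : (a b c d : V → ℕ) → ∑ (λ f → a f + b f + c f + d f) ≡ ∑ a + ∑ b + ∑ c + ∑ d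
  ∑-distrib-+₄ a b c d = trans (∑-distrib-+ _ d) (cong (_+ ∑ d) (trans (∑-distrib-+ _ c) (cong (_+ ∑ c) (∑-distrib-+ a b))))
  table : ∀ a b c → 4 * (𝟙 a * 𝟙 b * 𝟙 c) + 𝟙 (a xor b) + 𝟙 (a xor c) + 𝟙 (b xor c) ≡ 𝟙 a + 𝟙 b + 𝟙 c + 𝟙 ((a xor b) xor c)
  table true true true = refl
  table true true false = refl
  table true false true = refl
  table true false false = refl
  table false true true = refl
  table false true false = refl
  table false false true = refl
  table false false false = refl
  pointwise : ∀ f → 4 * (𝟙 (f ∙ x) * 𝟙 (f ∙ y) * 𝟙 (f ∙ z)) + 𝟙 (f ∙ (x ⊕ y)) + 𝟙 (f ∙ (x ⊕ z)) + 𝟙 (f ∙ (y ⊕ z))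
                  ≡ 𝟙 (f ∙ x) + 𝟙 (f ∙ y) + 𝟙 (f ∙ z) + 𝟙 (f ∙ ((x ⊕ y) ⊕ z))
  pointwise f rewrite ∙-distribʳ-⊕ f x y | ∙-distribʳ-⊕ f x z | ∙-distribʳ-⊕ f y z | ∙-distribʳ-⊕ f (x ⊕ y) z | ∙-distribʳ-⊕ f x y =
    table (f ∙ x) (f ∙ y) (f ∙ z)

Φ₂-nonzero : (x y : V) → ¬ x ≡ 𝟎 → ¬ y ≡ 𝟎 → Φ₂ x y ≡ 32 + 32 * ⟦ x ≟ᵥ y ⟧
Φ₂-nonzero x y x≢𝟎 y≢𝟎 with x ≟ᵥ y
... | yes refl = trans (∑-cong (λ f → 𝟙-idem (f ∙ x))) (Φ-nonzero x x≢𝟎)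
... | no x≢y = *-cancelˡ-≡ _ _ 2 (+-cancelʳ-≡ 64 _ _ (begin
  2 * Φ₂ x y + 64      ≡⟨ cong (2 * Φ₂ x y +_) (Φ-nonzero (x ⊕ y) (x≢y ∘ ⊕≡𝟎⇒≡ x y)) ⟨
  2 * Φ₂ x y + Φ (x ⊕ y) ≡⟨ 2Φ₂+Φ≡Φ+Φ x y ⟩
  Φ x + Φ y            ≡⟨ cong₂ _+_ {_} {64} {_} {64} (Φ-nonzero x x≢𝟎) (Φ-nonzero y y≢𝟎) ⟩
  128                  ∎))
  where open ≡-Reasoning

Φ₃-nonzero : (x y z : V) → ¬ x ≡ 𝟎 → ¬ y ≡ 𝟎 → ¬ z ≡ 𝟎 →
  Φ₃ x y z + 16 * ⟦ x ⊕ y ≟ᵥ z ⟧ ≡ 16 + 16 * (⟦ x ≟ᵥ y ⟧ + ⟦ x ≟ᵥ z ⟧ + ⟦ y ≟ᵥ z ⟧)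
Φ₃-nonzero x y z x≢𝟎 y≢𝟎 z≢𝟎 =
  solve-linear (Φ₃ x y z) (Φ (x ⊕ y)) (Φ (x ⊕ z)) (Φ (y ⊕ z)) (Φ ((x ⊕ y) ⊕ z)) ⟦ x ≟ᵥ y ⟧ ⟦ x ≟ᵥ z ⟧ ⟦ y ≟ᵥ z ⟧ ⟦ x ⊕ y ≟ᵥ z ⟧
    (trans (4Φ₃+Φ+Φ+Φ≡Φ+Φ+Φ+Φ x y z) (cong (_+ Φ ((x ⊕ y) ⊕ z)) Φ+Φ+Φ≡192))
    (Φ-⊕ x y) (Φ-⊕ x z) (Φ-⊕ y z) (Φ-⊕ (x ⊕ y) z)
  where
  Φ+Φ+Φ≡192 : Φ x + Φ y + Φ z ≡ 192
  Φ+Φ+Φ≡192 rewrite Φ-nonzero x x≢𝟎 | Φ-nonzero y y≢𝟎 | Φ-nonzero z z≢𝟎 = refl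
  solve-linear : ∀ t a b c d p q r e → 4 * t + a + b + c ≡ 192 + d →
    a + 64 * p ≡ 64 → b + 64 * q ≡ 64 → c + 64 * r ≡ 64 → d + 64 * e ≡ 64 →
    t + 16 * e ≡ 16 + 16 * (p + q + r)
  solve-linear t a b c d p q r e h ha hb hc hd = *-cancelˡ-≡ _ _ 4 (+-cancelʳ-≡ (a + b + c) _ _ (trans lhs (sym rhs)))
    where
    lhs : 4 * (t + 16 * e) + (a + b + c) ≡ 256
    lhs = begin
      4 * (t + 16 * e) + (a + b + c)  ≡⟨ solve-∀′ t a b c e ⟩
      (4 * t + a + b + c) + 64 * e    ≡⟨ cong (_+ 64 * e) h ⟩
      192 + d + 64 * e                ≡⟨ +-assoc 192 d (64 * e) ⟩
      192 + (d + 64 * e)              ≡⟨ cong (192 +_) hd ⟩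
      256                             ∎
      where
      open ≡-Reasoning
      solve-∀′ : ∀ t a b c e → 4 * (t + 16 * e) + (a + b + c) ≡ (4 * t + a + b + c) + 64 * e
      solve-∀′ = solve-∀
    rhs : 4 * (16 + 16 * (p + q + r)) + (a + b + c) ≡ 256
    rhs = begin
      4 * (16 + 16 * (p + q + r)) + (a + b + c)         ≡⟨ solve-∀′ p q r a b c ⟩
      64 + (a + 64 * p) + (b + 64 * q) + (c + 64 * r)   ≡⟨ cong₂ (λ u v → 64 + u + v + (c + 64 * r)) ha hb ⟩
      64 + 64 + 64 + (c + 64 * r)                       ≡⟨ cong (192 +_) hc ⟩
      256                                               ∎
      where
      open ≡-Reasoning
      solve-∀′ : ∀ p q r a b c → 4 * (16 + 16 * (p + q + r)) + (a + b + c) ≡ 64 + (a + 64 * p) + (b + 64 * q) + (c + 64 * r)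
      solve-∀′ = solve-∀

-- Moments of the hyperplane counts

module Moments {P : V → Set} (P? : (x : V) → Dec (P x)) (P⇒≢𝟎 : ∀ {x} → P x → ¬ x ≡ 𝟎) {s : ℕ} (|P|≡s : ∑ (λ x → ⟦ P? x ⟧) ≡ s) where

  N : V → ℕ
  N x = ⟦ P? x ⟧

  c : V → ℕ
  c = off P?

  -- six for every line contained in P
  linePairs : ℕ
  linePairs = ∑ (λ x → ∑ (λ y → N x * N y * N (x ⊕ y)))

  ∑-N* : (a : ℕ) → ∑ (λ x → N x * a) ≡ s * a
  ∑-N* a = trans (sym (*-distribʳ-∑ a N)) (cong (_* a) |P|≡s)

  ∑-c : ∑ c ≡ 64 * s
  ∑-c = begin
    ∑ (λ f → ∑ (λ x → N x * 𝟙 (f ∙ x)))  ≡⟨ ∑-comm _ ⟩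
    ∑ (λ x → ∑ (λ f → N x * 𝟙 (f ∙ x)))  ≡⟨ ∑-cong (λ x → sym (*-distribˡ-∑ (N x) _)) ⟩
    ∑ (λ x → N x * Φ x)                  ≡⟨ ∑-cong (λ x → guard (P? x) (λ px → Φ-nonzero x (P⇒≢𝟎 px))) ⟩
    ∑ (λ x → N x * 64)                   ≡⟨ ∑-N* 64 ⟩
    s * 64                               ≡⟨ *-comm s 64 ⟩
    64 * s                               ∎
    where open ≡-Reasoning

  ∑∑-NN : ∑ (λ x → ∑ (λ y → N x * N y)) ≡ s * s
  ∑∑-NN = trans (sym (∑-*-∑ N N)) (cong₂ _*_ |P|≡s |P|≡s)

  ∑∑-NNδ : ∑ (λ x → ∑ (λ y → N x * N y * ⟦ x ≟ᵥ y ⟧)) ≡ s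
  ∑∑-NNδ = trans (∑-cong (∑-diagonal P?)) |P|≡s

  ∑-c² : ∑ (λ f → c f * c f) ≡ 32 * (s * s) + 32 * s
  ∑-c² = begin
    ∑ (λ f → c f * c f)
      ≡⟨ ∑-cong (λ f → ∑-*-∑ _ _) ⟩
    ∑ (λ f → ∑ (λ x → ∑ (λ y → (N x * 𝟙 (f ∙ x)) * (N y * 𝟙 (f ∙ y)))))
      ≡⟨ trans (∑-comm _) (∑-cong (λ x → ∑-comm _)) ⟩
    ∑ (λ x → ∑ (λ y → ∑ (λ f → (N x * 𝟙 (f ∙ x)) * (N y * 𝟙 (f ∙ y)))))
      ≡⟨ ∑-cong (λ x → ∑-cong (λ y → trans (∑-cong (λ f → shuffle (N x) (𝟙 (f ∙ x)) (N y) (𝟙 (f ∙ y)))) (sym (*-distribˡ-∑ (N x * N y) _)))) ⟩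
    ∑ (λ x → ∑ (λ y → N x * N y * Φ₂ x y))
      ≡⟨ ∑-linear 32 32 (λ x → ∑-linear 32 32 (λ y → pointwise x y)) ⟩
    32 * ∑ (λ x → ∑ (λ y → N x * N y)) + 32 * ∑ (λ x → ∑ (λ y → N x * N y * ⟦ x ≟ᵥ y ⟧))
      ≡⟨ cong₂ (λ a b → 32 * a + 32 * b) ∑∑-NN ∑∑-NNδ ⟩
    32 * (s * s) + 32 * s
      ∎
    where
    open ≡-Reasoning
    shuffle : ∀ a b c d → (a * b) * (c * d) ≡ (a * c) * (b * d)
    shuffle = solve-∀
    pointwise : ∀ x y → N x * N y * Φ₂ x y ≡ 32 * (N x * N y) + 32 * (N x * N y * ⟦ x ≟ᵥ y ⟧)
    pointwise x y = begin
      N x * N y * Φ₂ x y                  ≡⟨ *-assoc (N x) (N y) _ ⟩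
      N x * (N y * Φ₂ x y)                ≡⟨ guard (P? x) (λ px → guard (P? y) (λ py → Φ₂-nonzero x y (P⇒≢𝟎 px) (P⇒≢𝟎 py))) ⟩
      N x * (N y * (32 + 32 * ⟦ x ≟ᵥ y ⟧)) ≡⟨ expand (N x) (N y) ⟦ x ≟ᵥ y ⟧ ⟩
      32 * (N x * N y) + 32 * (N x * N y * ⟦ x ≟ᵥ y ⟧) ∎
      where
      expand : ∀ a b d → a * (b * (32 + 32 * d)) ≡ 32 * (a * b) + 32 * (a * b * d)
      expand = solve-∀

  ∑-*N : (a : ℕ) → ∑ (λ x → a * N x) ≡ a * s
  ∑-*N a = trans (sym (*-distribˡ-∑ a N)) (cong (a *_) |P|≡s)

  ∑∑-*ʳ : (h : V → V → ℕ) (a : ℕ) → ∑ (λ x → ∑ (λ y → h x y * a)) ≡ ∑ (λ x → ∑ (λ y → h x y)) * a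
  ∑∑-*ʳ h a = trans (∑-cong (λ x → sym (*-distribʳ-∑ a (h x)))) (sym (*-distribʳ-∑ a _))

  ∑∑∑-NNNδxy : ∑ (λ x → ∑ (λ y → ∑ (λ z → N x * N y * N z * ⟦ x ≟ᵥ y ⟧))) ≡ s * s
  ∑∑∑-NNNδxy = begin
    ∑ (λ x → ∑ (λ y → ∑ (λ z → N x * N y * N z * ⟦ x ≟ᵥ y ⟧)))
      ≡⟨ ∑-cong (λ x → ∑-cong (λ y → trans (∑-cong (λ z → shuffle (N x) (N y) (N z) _)) (∑-*N (N x * N y * ⟦ x ≟ᵥ y ⟧)))) ⟩
    ∑ (λ x → ∑ (λ y → N x * N y * ⟦ x ≟ᵥ y ⟧ * s))
      ≡⟨ trans (∑∑-*ʳ _ s) (cong (_* s) ∑∑-NNδ) ⟩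
    s * s ∎
    where
    open ≡-Reasoning
    shuffle : ∀ a b c d → a * b * c * d ≡ a * b * d * c
    shuffle = solve-∀

  ∑∑∑-NNNδxz : ∑ (λ x → ∑ (λ y → ∑ (λ z → N x * N y * N z * ⟦ x ≟ᵥ z ⟧))) ≡ s * s
  ∑∑∑-NNNδxz = begin
    ∑ (λ x → ∑ (λ y → ∑ (λ z → N x * N y * N z * ⟦ x ≟ᵥ z ⟧)))
      ≡⟨ ∑-cong (λ x → ∑-comm _) ⟩
    ∑ (λ x → ∑ (λ z → ∑ (λ y → N x * N y * N z * ⟦ x ≟ᵥ z ⟧)))
      ≡⟨ ∑-cong (λ x → ∑-cong (λ z → trans (∑-cong (λ y → shuffle (N x) (N y) (N z) _)) (∑-*N (N x * N z * ⟦ x ≟ᵥ z ⟧)))) ⟩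
    ∑ (λ x → ∑ (λ z → N x * N z * ⟦ x ≟ᵥ z ⟧ * s))
      ≡⟨ trans (∑∑-*ʳ _ s) (cong (_* s) ∑∑-NNδ) ⟩
    s * s ∎
    where
    open ≡-Reasoning
    shuffle : ∀ a b c d → a * b * c * d ≡ a * c * d * b
    shuffle = solve-∀

  ∑∑∑-NNNδyz : ∑ (λ x → ∑ (λ y → ∑ (λ z → N x * N y * N z * ⟦ y ≟ᵥ z ⟧))) ≡ s * s
  ∑∑∑-NNNδyz = begin
    ∑ (λ x → ∑ (λ y → ∑ (λ z → N x * N y * N z * ⟦ y ≟ᵥ z ⟧)))
      ≡⟨ ∑-cong (λ x → trans (∑-cong (λ y → trans (∑-cong (λ z → shuffle (N x) (N y) (N z) _)) (sym (*-distribˡ-∑ (N x) _))))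
                              (sym (*-distribˡ-∑ (N x) _))) ⟩
    ∑ (λ x → N x * ∑ (λ y → ∑ (λ z → N y * N z * ⟦ y ≟ᵥ z ⟧)))
      ≡⟨ trans (∑-cong (λ x → cong (N x *_) ∑∑-NNδ)) (∑-N* s) ⟩
    s * s ∎
    where
    open ≡-Reasoning
    shuffle : ∀ a b c d → a * b * c * d ≡ a * (b * c * d)
    shuffle = solve-∀

  ∑∑∑-NNN : ∑ (λ x → ∑ (λ y → ∑ (λ z → N x * N y * N z))) ≡ s * s * s
  ∑∑∑-NNN = trans (∑-cong (λ x → ∑-cong (λ y → ∑-*N (N x * N y)))) (trans (∑∑-*ʳ (λ x y → N x * N y) s) (cong (_* s) ∑∑-NN))

  ∑∑∑-NNN-line : ∑ (λ x → ∑ (λ y → ∑ (λ z → N x * N y * N z * ⟦ x ⊕ y ≟ᵥ z ⟧))) ≡ linePairs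
  ∑∑∑-NNN-line = ∑-cong (λ x → ∑-cong (λ y →
    trans (∑-cong (λ z → trans (*-comm (N x * N y * N z) _) (cong (_* (N x * N y * N z)) (⟦≟ᵥ⟧-sym (x ⊕ y) z))))
          (∑-δ (x ⊕ y) (λ z → N x * N y * N z))))

  ∑-c³ : ∑ (λ f → c f * c f * c f) + 16 * linePairs ≡ 16 * (s * s * s) + 48 * (s * s)
  ∑-c³ = begin
    ∑ (λ f → c f * c f * c f) + 16 * linePairs
      ≡⟨ cong₂ (λ a b → a + 16 * b) (∑-cong cube) (sym ∑∑∑-NNN-line) ⟩
    ∑ (λ f → ∑ (λ x → ∑ (λ y → ∑ (λ z → term f x y z)))) + 16 * ∑ (λ x → ∑ (λ y → ∑ (λ z → w x y z * E x y z)))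
      ≡⟨ cong (_+ 16 * lines) (trans (∑-comm _) (∑-cong (λ x → trans (∑-comm _) (∑-cong (λ y → ∑-comm _))))) ⟩
    ∑ (λ x → ∑ (λ y → ∑ (λ z → ∑ (λ f → term f x y z)))) + 16 * ∑ (λ x → ∑ (λ y → ∑ (λ z → w x y z * E x y z)))
      ≡⟨ cong (_+ 16 * lines) (∑-cong (λ x → ∑-cong (λ y → ∑-cong (λ z → pull-out x y z)))) ⟩
    ∑ (λ x → ∑ (λ y → ∑ (λ z → w x y z * Φ₃ x y z))) + 16 * ∑ (λ x → ∑ (λ y → ∑ (λ z → w x y z * E x y z)))
      ≡⟨ ∑-linear′ 16 (λ x → ∑-linear′ 16 (λ y → ∑-linear′ 16 (λ z → pointwise x y z))) ⟩
    16 * ∑ (λ x → ∑ (λ y → ∑ (λ z → w x y z)))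
      + 16 * ∑ (λ x → ∑ (λ y → ∑ (λ z → w x y z * ⟦ x ≟ᵥ y ⟧ + w x y z * ⟦ x ≟ᵥ z ⟧ + w x y z * ⟦ y ≟ᵥ z ⟧)))
      ≡⟨ cong₂ (λ a b → 16 * a + 16 * b) ∑∑∑-NNN diagonals ⟩
    16 * (s * s * s) + 16 * (s * s + s * s + s * s)
      ≡⟨ cong (16 * (s * s * s) +_) (3× (s * s)) ⟩
    16 * (s * s * s) + 48 * (s * s)
      ∎
    where
    open ≡-Reasoning
    w : V → V → V → ℕ
    w x y z = N x * N y * N z
    E : V → V → V → ℕ
    E x y z = ⟦ x ⊕ y ≟ᵥ z ⟧
    lines : ℕ
    lines = ∑ (λ x → ∑ (λ y → ∑ (λ z → w x y z * E x y z)))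
    term : V → V → V → V → ℕ
    term f x y z = (N x * 𝟙 (f ∙ x)) * (N y * 𝟙 (f ∙ y)) * (N z * 𝟙 (f ∙ z))
    cube : ∀ f → c f * c f * c f ≡ ∑ (λ x → ∑ (λ y → ∑ (λ z → term f x y z)))
    cube f = begin
      c f * c f * c f                                                         ≡⟨ cong (_* c f) (∑-*-∑ _ _) ⟩
      ∑ (λ x → ∑ (λ y → (N x * 𝟙 (f ∙ x)) * (N y * 𝟙 (f ∙ y)))) * c f         ≡⟨ *-distribʳ-∑ (c f) _ ⟩
      ∑ (λ x → ∑ (λ y → (N x * 𝟙 (f ∙ x)) * (N y * 𝟙 (f ∙ y))) * c f)         ≡⟨ ∑-cong (λ x → *-distribʳ-∑ (c f) _) ⟩
      ∑ (λ x → ∑ (λ y → (N x * 𝟙 (f ∙ x)) * (N y * 𝟙 (f ∙ y)) * c f))         ≡⟨ ∑-cong (λ x → ∑-cong (λ y → *-distribˡ-∑ ((N x * 𝟙 (f ∙ x)) * (N y * 𝟙 (f ∙ y))) _)) ⟩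
      ∑ (λ x → ∑ (λ y → ∑ (λ z → term f x y z)))                              ∎
    pull-out : ∀ x y z → ∑ (λ f → term f x y z) ≡ w x y z * Φ₃ x y z
    pull-out x y z = trans (∑-cong (λ f → shuffle (N x) (𝟙 (f ∙ x)) (N y) (𝟙 (f ∙ y)) (N z) (𝟙 (f ∙ z)))) (sym (*-distribˡ-∑ (w x y z) _))
      where
      shuffle : ∀ a a′ b b′ c c′ → (a * a′) * (b * b′) * (c * c′) ≡ (a * b * c) * (a′ * b′ * c′)
      shuffle = solve-∀
    pointwise : ∀ x y z → w x y z * Φ₃ x y z + 16 * (w x y z * E x y z)
                        ≡ 16 * w x y z + 16 * (w x y z * ⟦ x ≟ᵥ y ⟧ + w x y z * ⟦ x ≟ᵥ z ⟧ + w x y z * ⟦ y ≟ᵥ z ⟧)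
    pointwise x y z = begin
      w x y z * Φ₃ x y z + 16 * (w x y z * E x y z)                ≡⟨ factor (N x) (N y) (N z) (Φ₃ x y z) (E x y z) ⟩
      N x * (N y * (N z * (Φ₃ x y z + 16 * E x y z)))              ≡⟨ guard (P? x) (λ px → guard (P? y) (λ py → guard (P? z) (λ pz →
                                                                        Φ₃-nonzero x y z (P⇒≢𝟎 px) (P⇒≢𝟎 py) (P⇒≢𝟎 pz)))) ⟩
      N x * (N y * (N z * (16 + 16 * (⟦ x ≟ᵥ y ⟧ + ⟦ x ≟ᵥ z ⟧ + ⟦ y ≟ᵥ z ⟧))))
        ≡⟨ expand (N x) (N y) (N z) ⟦ x ≟ᵥ y ⟧ ⟦ x ≟ᵥ z ⟧ ⟦ y ≟ᵥ z ⟧ ⟩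
      16 * w x y z + 16 * (w x y z * ⟦ x ≟ᵥ y ⟧ + w x y z * ⟦ x ≟ᵥ z ⟧ + w x y z * ⟦ y ≟ᵥ z ⟧) ∎
      where
      factor : ∀ a b c t e → a * b * c * t + 16 * (a * b * c * e) ≡ a * (b * (c * (t + 16 * e)))
      factor = solve-∀
      expand : ∀ a b c p q r → a * (b * (c * (16 + 16 * (p + q + r)))) ≡ 16 * (a * b * c) + 16 * (a * b * c * p + a * b * c * q + a * b * c * r)
      expand = solve-∀
    diagonals : ∑ (λ x → ∑ (λ y → ∑ (λ z → w x y z * ⟦ x ≟ᵥ y ⟧ + w x y z * ⟦ x ≟ᵥ z ⟧ + w x y z * ⟦ y ≟ᵥ z ⟧)))
                ≡ s * s + s * s + s * s
    diagonals = begin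
      ∑ (λ x → ∑ (λ y → ∑ (λ z → w x y z * ⟦ x ≟ᵥ y ⟧ + w x y z * ⟦ x ≟ᵥ z ⟧ + w x y z * ⟦ y ≟ᵥ z ⟧)))
        ≡⟨ ∑∑∑-distrib-+₃ _ _ _ ⟩
      ∑ (λ x → ∑ (λ y → ∑ (λ z → w x y z * ⟦ x ≟ᵥ y ⟧))) + ∑ (λ x → ∑ (λ y → ∑ (λ z → w x y z * ⟦ x ≟ᵥ z ⟧)))
        + ∑ (λ x → ∑ (λ y → ∑ (λ z → w x y z * ⟦ y ≟ᵥ z ⟧)))
        ≡⟨ cong₂ _+_ (cong₂ _+_ ∑∑∑-NNNδxy ∑∑∑-NNNδxz) ∑∑∑-NNNδyz ⟩
      s * s + s * s + s * s ∎
      where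
      ∑∑∑ : (V → V → V → ℕ) → ℕ
      ∑∑∑ h = ∑ (λ x → ∑ (λ y → ∑ (λ z → h x y z)))
      ∑∑∑-distrib-+ : (g h : V → V → V → ℕ) → ∑∑∑ (λ x y z → g x y z + h x y z) ≡ ∑∑∑ g + ∑∑∑ h
      ∑∑∑-distrib-+ g h = trans (∑-cong (λ x → trans (∑-cong (λ y → ∑-distrib-+ _ _)) (∑-distrib-+ _ _))) (∑-distrib-+ _ _)
      ∑∑∑-distrib-+₃ : (a b d : V → V → V → ℕ) → ∑∑∑ (λ x y z → a x y z + b x y z + d x y z) ≡ ∑∑∑ a + ∑∑∑ b + ∑∑∑ d
      ∑∑∑-distrib-+₃ a b d = trans (∑∑∑-distrib-+ _ d) (cong (_+ ∑∑∑ d) (∑∑∑-distrib-+ a b))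
    3× : ∀ t → 16 * (t + t + t) ≡ 48 * t
    3× = solve-∀

module Spectrum {P : V → Set} (P? : (x : V) → Dec (P x)) (P⇒≢𝟎 : ∀ {x} → P x → ¬ x ≡ 𝟎)
  (|P|≡15 : ∑ (λ x → ⟦ P? x ⟧) ≡ 15) (4∣c : ∀ f → 4 ∣ off P? f) (c≢0 : ∀ f → ¬ f ≡ 𝟎 → ¬ off P? f ≡ 0) where

  open Moments P? P⇒≢𝟎 |P|≡15 public

  c≤15 : (f : V) → c f ≤ 15
  c≤15 f = ≤-trans (∑-mono-≤ (λ x → bound (N x) (f ∙ x))) (≤-reflexive |P|≡15)
    where
    bound : ∀ a b → a * 𝟙 b ≤ a
    bound a true = ≤-reflexive (*-identityʳ a)
    bound a false = subst (_≤ a) (sym (*-zeroʳ a)) z≤n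

  c𝟎 : c 𝟎 ≡ 0
  c𝟎 = trans (∑-cong (λ x → trans (cong (λ b → N x * 𝟙 b) (∙-zeroˡ x)) (*-zeroʳ (N x)))) ∑-zero

  c-values : (f : V) → ¬ f ≡ 𝟎 → c f ≡ 4 ⊎ c f ≡ 8 ⊎ c f ≡ 12
  c-values f f≢𝟎 with 4∣c f
  ... | divides 0 c≡0 = ⊥-elim (c≢0 f f≢𝟎 c≡0)
  ... | divides 1 c≡4 = inj₁ c≡4
  ... | divides 2 c≡8 = inj₂ (inj₁ c≡8)
  ... | divides 3 c≡12 = inj₂ (inj₂ c≡12)
  ... | divides (suc (suc (suc (suc q)))) c≡ = ⊥-elim (<-irrefl refl (≤-trans (s≤s (m≤m+n 15 (q * 4))) (subst (_≤ 15) c≡ (c≤15 f))))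

  -- (c − 4)(c − 8) = c² − 12c + 32 vanishes at c = 4, 8 and is 32 at c = 0, 12;
  -- (c − 4)(c − 8)(c − 12) vanishes at c = 4, 8, 12 and is −384 at c = 0, i.e. at f = 0.
  quadratic : (f : V) → c f * c f + 32 ≡ 12 * c f + 32 * ⟦ c f ≟ 12 ⟧ + 32 * ⟦ f ≟ᵥ 𝟎 ⟧
  quadratic f with f ≟ᵥ 𝟎
  ... | yes refl rewrite c𝟎 = refl
  ... | no f≢𝟎 with c-values f f≢𝟎
  ... | inj₁ c≡4 rewrite c≡4 = refl
  ... | inj₂ (inj₁ c≡8) rewrite c≡8 = refl
  ... | inj₂ (inj₂ c≡12) rewrite c≡12 = refl

  cubic : (f : V) → c f * c f * c f + 176 * c f + 384 * ⟦ f ≟ᵥ 𝟎 ⟧ ≡ 24 * (c f * c f) + 384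
  cubic f with f ≟ᵥ 𝟎
  ... | yes refl rewrite c𝟎 = refl
  ... | no f≢𝟎 with c-values f f≢𝟎
  ... | inj₁ c≡4 rewrite c≡4 = refl
  ... | inj₂ (inj₁ c≡8) rewrite c≡8 = refl
  ... | inj₂ (inj₂ c≡12) rewrite c≡12 = refl

  ∑-[f≡𝟎] : ∑ (λ f → ⟦ f ≟ᵥ 𝟎 ⟧) ≡ 1
  ∑-[f≡𝟎] = trans (∑-cong (λ f → sym (*-identityʳ _))) (∑-δ 𝟎 (λ _ → 1))

  #c≡12 : ∑ (λ f → ⟦ c f ≟ 12 ⟧) ≡ 7
  #c≡12 = *-cancelˡ-≡ _ _ 32 (+-cancelʳ-≡ 11552 _ _ (begin
    32 * A + 11552
      ≡⟨ cong₂ (λ a z → 32 * A + (12 * a + 32 * z)) {_} {960} {_} {1} ∑-c ∑-[f≡𝟎] ⟨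
    32 * A + (12 * ∑ c + 32 * Z)
      ≡⟨ reorder A (∑ c) Z ⟩
    12 * ∑ c + 32 * A + 32 * Z
      ≡⟨ cong (_+ 32 * Z) (∑-linear 12 32 (λ _ → refl)) ⟨
    ∑ (λ f → 12 * c f + 32 * ⟦ c f ≟ 12 ⟧) + 32 * Z
      ≡⟨ cong (∑ (λ f → 12 * c f + 32 * ⟦ c f ≟ 12 ⟧) +_) (*-distribˡ-∑ 32 _) ⟩
    ∑ (λ f → 12 * c f + 32 * ⟦ c f ≟ 12 ⟧) + ∑ (λ f → 32 * ⟦ f ≟ᵥ 𝟎 ⟧)
      ≡⟨ ∑-distrib-+ _ _ ⟨
    ∑ (λ f → 12 * c f + 32 * ⟦ c f ≟ 12 ⟧ + 32 * ⟦ f ≟ᵥ 𝟎 ⟧)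
      ≡⟨ ∑-cong quadratic ⟨
    ∑ (λ f → c f * c f + 32)
      ≡⟨ trans (∑-distrib-+ _ _) (cong₂ _+_ {_} {32 * (15 * 15) + 32 * 15} {_} {2 ^ 7 * 32} ∑-c² (∑-const 32)) ⟩
    32 * 7 + 11552
      ∎))
    where
    open ≡-Reasoning
    A Z : ℕ
    A = ∑ (λ f → ⟦ c f ≟ 12 ⟧)
    Z = ∑ (λ f → ⟦ f ≟ᵥ 𝟎 ⟧)
    reorder : ∀ a b z → 32 * a + (12 * b + 32 * z) ≡ 12 * b + 32 * a + 32 * z
    reorder = solve-∀

  linePairs≡42 : linePairs ≡ 42
  linePairs≡42 = *-cancelˡ-≡ _ _ 16 (+-cancelʳ-≡ 233472 _ _ (begin
    16 * linePairs + 233472                              ≡⟨ cong (16 * linePairs +_) ∑-cubic ⟨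
    16 * linePairs + (C₃ + 176 * 960 + 384 * 1)          ≡⟨ reorder linePairs C₃ (176 * 960) (384 * 1) ⟩
    (C₃ + 16 * linePairs) + 176 * 960 + 384 * 1          ≡⟨ cong (λ t → t + 176 * 960 + 384 * 1) {_} {16 * (15 * 15 * 15) + 48 * (15 * 15)} ∑-c³ ⟩
    16 * 42 + 233472                                     ∎))
    where
    open ≡-Reasoning
    C₃ = ∑ (λ f → c f * c f * c f)
    reorder : ∀ d t a b → 16 * d + (t + a + b) ≡ (t + 16 * d) + a + b
    reorder = solve-∀
    ∑-cubic : C₃ + 176 * 960 + 384 * 1 ≡ 233472
    ∑-cubic = begin
      C₃ + 176 * 960 + 384 * 1
        ≡⟨ cong₂ (λ a z → C₃ + 176 * a + 384 * z) {_} {960} {_} {1} ∑-c ∑-[f≡𝟎] ⟨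
      C₃ + 176 * ∑ c + 384 * ∑ (λ f → ⟦ f ≟ᵥ 𝟎 ⟧)
        ≡⟨ cong₂ (λ a z → C₃ + a + z) (*-distribˡ-∑ 176 c) (*-distribˡ-∑ 384 _) ⟩
      C₃ + ∑ (λ f → 176 * c f) + ∑ (λ f → 384 * ⟦ f ≟ᵥ 𝟎 ⟧)
        ≡⟨ cong (_+ _) (∑-distrib-+ _ _) ⟨
      ∑ (λ f → c f * c f * c f + 176 * c f) + ∑ (λ f → 384 * ⟦ f ≟ᵥ 𝟎 ⟧)
        ≡⟨ ∑-distrib-+ _ _ ⟨
      ∑ (λ f → c f * c f * c f + 176 * c f + 384 * ⟦ f ≟ᵥ 𝟎 ⟧)
        ≡⟨ ∑-cong cubic ⟩
      ∑ (λ f → 24 * (c f * c f) + 384)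
        ≡⟨ trans (∑-distrib-+ _ _) (cong₂ _+_ (sym (*-distribˡ-∑ 24 _)) (∑-const 384)) ⟩
      24 * ∑ (λ f → c f * c f) + 2 ^ 7 * 384
        ≡⟨ cong (λ q → 24 * q + 2 ^ 7 * 384) {_} {32 * (15 * 15) + 32 * 15} ∑-c² ⟩
      233472
        ∎

-- The lines contained in the point set

module Structure {P : V → Set} (P? : (x : V) → Dec (P x)) (P⇒≢𝟎 : ∀ {x} → P x → ¬ x ≡ 𝟎)
  (|P|≡15 : ∑ (λ x → ⟦ P? x ⟧) ≡ 15) (4∣c : ∀ f → 4 ∣ off P? f) (c≢0 : ∀ f → ¬ f ≡ 𝟎 → ¬ off P? f ≡ 0) where

  open Spectrum P? P⇒≢𝟎 |P|≡15 4∣c c≢0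

  Section : V → V → Set
  Section f x = P x × f ∙ x ≡ false

  section? : (f x : V) → Dec (Section f x)
  section? f x = P? x ×-dec (f ∙ x Bool.≟ false)

  offBoth : V → V → ℕ
  offBoth f g = ∑ (λ x → N x * 𝟙 (f ∙ x ∧ g ∙ x))

  |Section|+c : (f : V) → ∑ (λ x → ⟦ section? f x ⟧) + c f ≡ 15
  |Section|+c f = trans (∑-+-≡ pointwise) |P|≡15
    where
    pointwise : ∀ x → ⟦ section? f x ⟧ + N x * 𝟙 (f ∙ x) ≡ N x
    pointwise x with P? x | f ∙ x
    ... | yes _ | true = refl
    ... | yes _ | false = refl
    ... | no _ | _ = refl

  2offBoth+c : (f g : V) → 2 * offBoth f g + c (f ⊕ g) ≡ c f + c g
  2offBoth+c f g = trans (cong (_+ c (f ⊕ g)) (*-distribˡ-∑ 2 _)) (trans (∑-+-≡ pointwise) (∑-distrib-+ _ _))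
    where
    pointwise : ∀ x → 2 * (N x * 𝟙 (f ∙ x ∧ g ∙ x)) + N x * 𝟙 ((f ⊕ g) ∙ x) ≡ N x * 𝟙 (f ∙ x) + N x * 𝟙 (g ∙ x)
    pointwise x rewrite ∙-distribˡ-⊕ f g x with P? x | f ∙ x | g ∙ x
    ... | yes _ | true | true = refl
    ... | yes _ | true | false = refl
    ... | yes _ | false | true = refl
    ... | yes _ | false | false = refl
    ... | no _ | _ | _ = refl

  |Section∩Section|+c+c : (f g : V) →
    ∑ (λ x → ⟦ section? f x ×-dec section? g x ⟧) + c f + c g ≡ 15 + offBoth f g
  |Section∩Section|+c+c f g =
    trans (cong (_+ c g) (∑-+-≡ (λ x → refl))) (trans (∑-+-≡ pointwise) (trans (∑-distrib-+ N _) (cong (_+ offBoth f g) |P|≡15)))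
    where
    pointwise : ∀ x → ⟦ section? f x ×-dec section? g x ⟧ + N x * 𝟙 (f ∙ x) + N x * 𝟙 (g ∙ x) ≡ N x + N x * 𝟙 (f ∙ x ∧ g ∙ x)
    pointwise x with P? x | f ∙ x | g ∙ x
    ... | yes _ | true | true = refl
    ... | yes _ | true | false = refl
    ... | yes _ | false | true = refl
    ... | yes _ | false | false = refl
    ... | no _ | _ | _ = refl

  Section-off+offBoth : (f g : V) → ∑ (λ x → ⟦ section? f x ⟧ * 𝟙 (g ∙ x)) + offBoth f g ≡ c g
  Section-off+offBoth f g = ∑-+-≡ pointwise
    where
    pointwise : ∀ x → ⟦ section? f x ⟧ * 𝟙 (g ∙ x) + N x * 𝟙 (f ∙ x ∧ g ∙ x) ≡ N x * 𝟙 (g ∙ x)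
    pointwise x with P? x | f ∙ x | g ∙ x
    ... | yes _ | true | true = refl
    ... | yes _ | true | false = refl
    ... | yes _ | false | true = refl
    ... | yes _ | false | false = refl
    ... | no _ | _ | _ = refl

  |Section|≡3 : ∀ {f} → c f ≡ 12 → ∑ (λ x → ⟦ section? f x ⟧) ≡ 3
  |Section|≡3 {f} c≡12 = +-cancelʳ-≡ 12 _ _ (trans (cong (∑ (λ x → ⟦ section? f x ⟧) +_) (sym c≡12)) (|Section|+c f))

  |Section∩Section|≡1 : ∀ {f g} → c f ≡ 12 → c g ≡ 12 → ¬ f ≡ g → ∑ (λ x → ⟦ section? f x ×-dec section? g x ⟧) ≡ 1
  |Section∩Section|≡1 {f} {g} cf≡12 cg≡12 f≢g =
    arith (c-values (f ⊕ g) (f≢g ∘ ⊕≡𝟎⇒≡ f g))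
      (trans (2offBoth+c f g) (cong₂ _+_ cf≡12 cg≡12))
      (trans (sym (+-assoc K 12 12)) (trans (cong₂ (λ a b → K + a + b) (sym cf≡12) (sym cg≡12)) (|Section∩Section|+c+c f g)))
    where
    K = ∑ (λ x → ⟦ section? f x ×-dec section? g x ⟧)
    B = offBoth f g
    24≰23 : ∀ k → ¬ k + 24 ≡ 23
    24≰23 k eq = <-irrefl refl (subst (24 ≤_) eq (m≤n+m 24 k))
    24≰21 : ∀ k → ¬ k + 24 ≡ 21
    24≰21 k eq = <-irrefl refl (≤-trans (n≤1+n 22) (≤-trans (n≤1+n 23) (subst (24 ≤_) eq (m≤n+m 24 k))))
    arith : c (f ⊕ g) ≡ 4 ⊎ c (f ⊕ g) ≡ 8 ⊎ c (f ⊕ g) ≡ 12 → 2 * B + c (f ⊕ g) ≡ 24 → K + 24 ≡ 15 + B → K ≡ 1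
    arith (inj₁ c≡4) h₁ h₂ = +-cancelʳ-≡ 24 K 1 (trans h₂ (cong (15 +_) B≡10))
      where
      B≡10 : B ≡ 10
      B≡10 = *-cancelˡ-≡ B 10 2 (+-cancelʳ-≡ 4 (2 * B) 20 (trans (cong (2 * B +_) (sym c≡4)) h₁))
    arith (inj₂ (inj₁ c≡8)) h₁ h₂ = ⊥-elim (24≰23 K (trans h₂ (cong (15 +_) B≡8)))
      where
      B≡8 : B ≡ 8
      B≡8 = *-cancelˡ-≡ B 8 2 (+-cancelʳ-≡ 8 (2 * B) 16 (trans (cong (2 * B +_) (sym c≡8)) h₁))
    arith (inj₂ (inj₂ c≡12)) h₁ h₂ = ⊥-elim (24≰21 K (trans h₂ (cong (15 +_) B≡6)))
      where
      B≡6 : B ≡ 6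
      B≡6 = *-cancelˡ-≡ B 6 2 (+-cancelʳ-≡ 12 (2 * B) 12 (trans (cong (2 * B +_) (sym c≡12)) h₁))

  Section-parity : ∀ {f} → c f ≡ 12 → ∀ g → ∃ λ m → ∑ (λ x → ⟦ section? f x ⟧ * 𝟙 (g ∙ x)) + 6 ≡ 2 * m
  Section-parity {f} c≡12 g with 4∣c g | 4∣c (f ⊕ g)
  ... | divides a cg≡ | divides b cfg≡ =
    a + b , *-cancelˡ-≡ _ _ 2 (+-cancelʳ-≡ (2 * B + c (f ⊕ g)) _ _ (trans (lhs Q B (c g) (c (f ⊕ g)) (Section-off+offBoth f g) h)
                                                                     (sym (rhs a b B (c g) (c (f ⊕ g)) cg≡ cfg≡ h))))
    where
    Q = ∑ (λ x → ⟦ section? f x ⟧ * 𝟙 (g ∙ x))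
    B = offBoth f g
    h : 2 * B + c (f ⊕ g) ≡ 12 + c g
    h = trans (2offBoth+c f g) (cong (_+ c g) c≡12)
    lhs : ∀ q b′ cg cfg → q + b′ ≡ cg → 2 * b′ + cfg ≡ 12 + cg → 2 * (q + 6) + (2 * b′ + cfg) ≡ 2 * cg + cfg + 12
    lhs q b′ cg cfg h₁ h₂ = trans (reorder q b′ cfg) (cong (λ t → 2 * t + cfg + 12) h₁)
      where
      reorder : ∀ q b′ cfg → 2 * (q + 6) + (2 * b′ + cfg) ≡ 2 * (q + b′) + cfg + 12
      reorder = solve-∀
    rhs : ∀ a b b′ cg cfg → cg ≡ a * 4 → cfg ≡ b * 4 → 2 * b′ + cfg ≡ 12 + cg → 2 * (2 * (a + b)) + (2 * b′ + cfg) ≡ 2 * cg + cfg + 12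
    rhs a b b′ cg cfg refl refl h₂ = trans (cong (2 * (2 * (a + b)) +_) h₂) (reorder a b)
      where
      reorder : ∀ a b → 2 * (2 * (a + b)) + (12 + a * 4) ≡ 2 * (a * 4) + b * 4 + 12
      reorder = solve-∀

  module SectionLine {f : V} (c≡12 : c f ≡ 12) where

    opaque
      E : Enumeration (Section f) 3
      E = subst (Enumeration (Section f)) (|Section|≡3 {f} c≡12) (enumerate (section? f))

    open Enumeration E

    p q r : V
    p = elem zero
    q = elem (suc zero)
    r = elem (suc (suc zero))

    p⊕q≡r : p ⊕ q ≡ r
    p⊕q≡r = ⊕≡𝟎⇒≡ (p ⊕ q) r (∙-nondegenerate _ g⊥)
      where
      g⊥ : ∀ g → g ∙ ((p ⊕ q) ⊕ r) ≡ false
      g⊥ g = begin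
        g ∙ ((p ⊕ q) ⊕ r)                ≡⟨ trans (∙-distribʳ-⊕ g (p ⊕ q) r) (cong (_xor g ∙ r) (∙-distribʳ-⊕ g p q)) ⟩
        ((g ∙ p) xor (g ∙ q)) xor g ∙ r  ≡⟨ even⇒xor≡false (g ∙ p) (g ∙ q) (g ∙ r) (proj₁ parity) three-terms ⟩
        false                            ∎
        where
        open ≡-Reasoning
        parity = Section-parity {f} c≡12 g
        three-terms : 𝟙 (g ∙ p) + (𝟙 (g ∙ q) + (𝟙 (g ∙ r) + 0)) + 6 ≡ 2 * proj₁ parity
        three-terms = trans (cong (_+ 6) (sym (∑-enumeration (section? f) E (λ x → 𝟙 (g ∙ x))))) (proj₂ parity)

    sectionLine : Line
    sectionLine = line p q (distinct⇒Indep2 p q (P⇒≢𝟎 (proj₁ (elem-∈ zero))) (P⇒≢𝟎 (proj₁ (elem-∈ (suc zero))))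
                                               (λ p≡q → 0≢1 (elem-injective zero (suc zero) p≡q)))
      where
      0≢1 : ¬ zero ≡ suc {2} zero
      0≢1 ()

    InLine⇒Section : ∀ {x} → InLine sectionLine x → x ≡ 𝟎 ⊎ Section f x
    InLine⇒Section x∈L with span₂-cases p q x∈L
    ... | inj₁ x≡𝟎 = inj₁ x≡𝟎
    ... | inj₂ (inj₁ refl) = inj₂ (elem-∈ zero)
    ... | inj₂ (inj₂ (inj₁ refl)) = inj₂ (elem-∈ (suc zero))
    ... | inj₂ (inj₂ (inj₂ refl)) = inj₂ (subst (Section f) (sym p⊕q≡r) (elem-∈ (suc (suc zero))))

    Section⇒InLine : ∀ {x} → Section f x → InLine sectionLine x
    Section⇒InLine x∈ with elem-surjective x∈
    ... | zero , refl = span₂-left p q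
    ... | suc zero , refl = span₂-right p q
    ... | suc (suc zero) , refl = subst (InSpan2 p q) p⊕q≡r (span₂-sum p q)

  opaque
    Fs : Enumeration (λ f → c f ≡ 12) 7
    Fs = subst (Enumeration (λ f → c f ≡ 12)) #c≡12 (enumerate (λ f → c f ≟ 12))

  F : Fin 7 → V
  F = Enumeration.elem Fs

  c-F : ∀ i → c (F i) ≡ 12
  c-F = Enumeration.elem-∈ Fs

  module Lᵢ (i : Fin 7) = SectionLine {F i} (c-F i)

  L : Fin 7 → Line
  L i = Lᵢ.sectionLine i

  |Section-F∩Section-F|≡1 : ∀ {i j} → ¬ i ≡ j → ∑ (λ x → ⟦ section? (F i) x ×-dec section? (F j) x ⟧) ≡ 1
  |Section-F∩Section-F|≡1 {i} {j} i≢j = |Section∩Section|≡1 (c-F i) (c-F j) (i≢j ∘ Enumeration.elem-injective Fs i j)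

  L⊆P : ∀ i {x} → InLine (L i) x → ¬ x ≡ 𝟎 → P x
  L⊆P i x∈L x≢𝟎 with Lᵢ.InLine⇒Section i x∈L
  ... | inj₁ x≡𝟎 = ⊥-elim (x≢𝟎 x≡𝟎)
  ... | inj₂ (px , _) = px

  L-distinct : ∀ i j → ¬ i ≡ j → ¬ SameLine (L i) (L j)
  L-distinct i j i≢j same = p≢q (∑≡1⇒unique (λ x → section? (F i) x ×-dec section? (F j) x) (|Section-F∩Section-F|≡1 i≢j) (shared p-∈) (shared q-∈))
    where
    open Lᵢ i using (p; q)
    p-∈ = Enumeration.elem-∈ (Lᵢ.E i) zero
    q-∈ = Enumeration.elem-∈ (Lᵢ.E i) (suc zero)
    p≢q : ¬ p ≡ q
    p≢q p≡q with Enumeration.elem-injective (Lᵢ.E i) zero (suc zero) p≡q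
    ... | ()
    shared : ∀ {x} → Section (F i) x → Section (F i) x × Section (F j) x
    shared {x} x∈ with Lᵢ.InLine⇒Section j (proj₁ (same x) (Lᵢ.Section⇒InLine i x∈))
    ... | inj₁ x≡𝟎 = ⊥-elim (P⇒≢𝟎 (proj₁ x∈) x≡𝟎)
    ... | inj₂ x∈′ = x∈ , x∈′

  L-not-skew : ∀ i j → ¬ i ≡ j → ¬ Skew (L i) (L j)
  L-not-skew i j i≢j skew = P⇒≢𝟎 (proj₁ x∈ᵢ) (skew x (Lᵢ.Section⇒InLine i x∈ᵢ) (Lᵢ.Section⇒InLine j x∈ⱼ))
    where
    common = ∑-pos (λ x → ⟦ section? (F i) x ×-dec section? (F j) x ⟧) (≤-reflexive (sym (|Section-F∩Section-F|≡1 i≢j)))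
    x = proj₁ common
    x∈ᵢ = proj₁ (⟦⟧-pos (section? (F i) x ×-dec section? (F j) x) (proj₂ common))
    x∈ⱼ = proj₂ (⟦⟧-pos (section? (F i) x ×-dec section? (F j) x) (proj₂ common))

  distinctPair? : (i : Fin 7) (x y : V) → Dec (Section (F i) x × (Section (F i) y × ¬ x ≡ y))
  distinctPair? i x y = section? (F i) x ×-dec (section? (F i) y ×-dec ¬? (x ≟ᵥ y))

  linesThrough : V → V → ℕ
  linesThrough x y = ∑ᶠ (λ i → ⟦ distinctPair? i x y ⟧)

  linesThrough≤ : ∀ x y → linesThrough x y ≤ N x * N y * N (x ⊕ y)
  linesThrough≤ x y with any? (λ i → distinctPair? i x y)
  ... | no none = subst (_≤ N x * N y * N (x ⊕ y)) (sym (trans (∑ᶠ-cong absent) (∑ᶠ-const {7} 0))) z≤n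
    where
    absent : ∀ i → ⟦ distinctPair? i x y ⟧ ≡ 0
    absent i = cong 𝟙 (dec-false (distinctPair? i x y) (λ pair → none (i , pair)))
  ... | yes (i , x∈ , y∈ , x≢y) = ≤-reflexive (trans (∑ᶠ-single _ i others) (trans (cong 𝟙 (dec-true (distinctPair? i x y) (x∈ , y∈ , x≢y))) (sym NNN≡1)))
    where
    others : ∀ j → ¬ j ≡ i → ⟦ distinctPair? j x y ⟧ ≡ 0
    others j j≢i = cong 𝟙 (dec-false (distinctPair? j x y) λ (x∈′ , y∈′ , _) →
      x≢y (∑≡1⇒unique (λ z → section? (F j) z ×-dec section? (F i) z) (|Section-F∩Section-F|≡1 j≢i) (x∈′ , x∈) (y∈′ , y∈)))
    x⊕y∈L : InLine (L i) (x ⊕ y)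
    x⊕y∈L = span₂-⊕ (Lᵢ.p i) (Lᵢ.q i) (Lᵢ.Section⇒InLine i x∈) (Lᵢ.Section⇒InLine i y∈)
    N≡1 : ∀ {z} → P z → N z ≡ 1
    N≡1 {z} pz = cong 𝟙 (dec-true (P? z) pz)
    NNN≡1 : N x * N y * N (x ⊕ y) ≡ 1
    NNN≡1 = cong₂ _*_ (cong₂ _*_ (N≡1 (proj₁ x∈)) (N≡1 (proj₁ y∈))) (N≡1 (L⊆P i x⊕y∈L (x≢y ∘ ⊕≡𝟎⇒≡ x y)))

  ∑∑-linesThrough : ∑ (λ x → ∑ (λ y → linesThrough x y)) ≡ 42
  ∑∑-linesThrough = begin
    ∑ (λ x → ∑ (λ y → ∑ᶠ (λ i → ⟦ distinctPair? i x y ⟧)))  ≡⟨ ∑-cong (λ x → ∑-∑ᶠ-comm (λ i y → ⟦ distinctPair? i x y ⟧)) ⟩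
    ∑ (λ x → ∑ᶠ (λ i → ∑ (λ y → ⟦ distinctPair? i x y ⟧)))  ≡⟨ ∑-∑ᶠ-comm (λ i x → ∑ (λ y → ⟦ distinctPair? i x y ⟧)) ⟩
    ∑ᶠ (λ i → ∑ (λ x → ∑ (λ y → ⟦ distinctPair? i x y ⟧)))  ≡⟨ ∑ᶠ-cong six ⟩
    ∑ᶠ {7} (λ _ → 6)                                         ≡⟨ ∑ᶠ-const {7} 6 ⟩
    42                                                       ∎
    where
    open ≡-Reasoning
    six : ∀ i → ∑ (λ x → ∑ (λ y → ⟦ distinctPair? i x y ⟧)) ≡ 6
    six i = +-cancelʳ-≡ 3 _ 6 (∑∑-distinct (section? (F i)) (|Section|≡3 {F i} (c-F i)))

  linesThrough≡ : ∀ x y → linesThrough x y ≡ N x * N y * N (x ⊕ y)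
  linesThrough≡ x = ∑-tight (linesThrough≤ x) (∑-tight (λ x → ∑-mono-≤ (linesThrough≤ x)) (trans ∑∑-linesThrough (sym linePairs≡42)) x)

  L-complete : (M : Line) → (∀ x → InLine M x → ¬ x ≡ 𝟎 → P x) → ∃ λ i → SameLine M (L i)
  L-complete (line u v ind) M⊆P = i , λ x → M⊆Lᵢ , Lᵢ⊆M
    where
    open Independent u v ind
    N≡1 : ∀ {z} → P z → N z ≡ 1
    N≡1 {z} pz = cong 𝟙 (dec-true (P? z) pz)
    NNN≡1 : N u * N v * N (u ⊕ v) ≡ 1
    NNN≡1 = cong₂ _*_ (cong₂ _*_ (N≡1 (M⊆P u (span₂-left u v) u≢𝟎)) (N≡1 (M⊆P v (span₂-right u v) v≢𝟎))) (N≡1 (M⊆P (u ⊕ v) (span₂-sum u v) u⊕v≢𝟎))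
    on-a-line : ∃ λ i → 0 < ⟦ distinctPair? i u v ⟧
    on-a-line = ∑ᶠ-pos (λ i → ⟦ distinctPair? i u v ⟧) (≤-reflexive (sym (trans (linesThrough≡ u v) NNN≡1)))
    i = proj₁ on-a-line
    u∈ : Section (F i) u
    u∈ = proj₁ (⟦⟧-pos (distinctPair? i u v) (proj₂ on-a-line))
    v∈ : Section (F i) v
    v∈ = proj₁ (proj₂ (⟦⟧-pos (distinctPair? i u v) (proj₂ on-a-line)))
    u⊕v∈ : Section (F i) (u ⊕ v)
    u⊕v∈ = M⊆P (u ⊕ v) (span₂-sum u v) u⊕v≢𝟎 , trans (∙-distribʳ-⊕ (F i) u v) (cong₂ _xor_ (proj₂ u∈) (proj₂ v∈))
    M⊆Lᵢ : ∀ {x} → InSpan2 u v x → InLine (L i) x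
    M⊆Lᵢ x∈M = cases (span₂-cases u v x∈M)
      where
      cases : ∀ {x} → x ≡ 𝟎 ⊎ x ≡ u ⊎ x ≡ v ⊎ x ≡ u ⊕ v → InLine (L i) x
      cases (inj₁ refl) = span₂-𝟎 (Lᵢ.p i) (Lᵢ.q i)
      cases (inj₂ (inj₁ refl)) = Lᵢ.Section⇒InLine i u∈
      cases (inj₂ (inj₂ (inj₁ refl))) = Lᵢ.Section⇒InLine i v∈
      cases (inj₂ (inj₂ (inj₂ refl))) = Lᵢ.Section⇒InLine i u⊕v∈
    Lᵢ⊆M : ∀ {x} → InLine (L i) x → InSpan2 u v x
    Lᵢ⊆M x∈L = cases (Lᵢ.InLine⇒Section i x∈L)
      where
      one-of : ∀ {x} → x ≡ u ⊎ x ≡ v ⊎ x ≡ u ⊕ v → InSpan2 u v x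
      one-of (inj₁ refl) = span₂-left u v
      one-of (inj₂ (inj₁ refl)) = span₂-right u v
      one-of (inj₂ (inj₂ refl)) = span₂-sum u v
      cases : ∀ {x} → x ≡ 𝟎 ⊎ Section (F i) x → InSpan2 u v x
      cases (inj₁ refl) = span₂-𝟎 u v
      cases (inj₂ x∈) = one-of (∑≡3⇒exhaust (section? (F i)) (|Section|≡3 {F i} (c-F i)) u∈ v∈ u⊕v∈ u≢v u≢u⊕v v≢u⊕v x∈)

lemma4p8 : (S : Fin 16 → Plane) → IsPartialPlaneSpread S → HolesSpanAll S →
    Σ (Fin 7 → Line) λ L →
    (∀ i → LineInHoles S (L i))
    × (∀ i j → ¬ (i ≡ j) → ¬ SameLine (L i) (L j))
    × (∀ (M : Line) → LineInHoles S M → ∃ λ i → SameLine M (L i))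
    × (∀ i j → ¬ (i ≡ j) → ¬ Skew (L i) (L j))
lemma4p8 S spread span = L , (λ i x x∈L → L⊆P i x∈L) , L-distinct , L-complete , L-not-skew
  where
  open Holes S spread
  fifteen-holes : ∑ (λ x → ⟦ isHole? x ⟧) ≡ 15
  fifteen-holes = +-cancelʳ-≡ 112 _ _ hole-count
  open Structure isHole? proj₁ fifteen-holes 4∣off (off≢0 span)
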